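{- Let $\Gamma$ be a directed graph with at least one arc, and let $k$ be the sum over all vertices of $\Gamma$ of their in-degrees and out-degrees. Then the graph obtained by applying the Quick HCP to 3HCP Conversion Procedure to $\Gamma$ contains no more than $25k$ vertices.
   Context: Directed graphs have no loops and no two arcs with the same tail and head (undirected edges count as two opposite arcs). A split replaces a vertex $w$ by $p,q$ with arc $(p,q)$; arcs into $w$ go into $p$, arcs out of $w$ leave from $q$. An in-split replaces $w$ by $p,q,t$ with arcs $(p,q),(q,p),(p,t),(q,t)$; arcs into $w$ are divided between $p$ and $q$ (numbers differing by at most one); arcs out of $w$ leave from $t$. An out-split replaces $w$ by $p,q,t$ with arcs $(p,q),(p,t),(q,t),(t,q)$; arcs into $w$ go into $p$; arcs out of $w$ are divided between $q$ and $t$ (numbers differing by at most one). The Splitting Procedure for a vertex $v$ with parameter $d$: replace $v$ by a split; then while some vertex of the replacing subgraph has in-degree $>d$ replace it by an in-split; then while some vertex of the replacing subgraph has out-degree $>d$ replace it by an out-split. The 4-gate is the undirected graph on $\{1,\dots,11\}$ with edges $\{1,3\},\{1,8\},\{2,3\},\{2,5\},\{3,4\},\{4,5\},\{4,6\},\{6,7\},\{7,8\},\{7,10\},\{8,9\},\{9,10\},\{10,11\},\{5,11\}$ and attachment vertices $1,2,9,11$. Quick HCP to 3HCP Conversion Procedure: (1) perform the Splitting Procedure with $d=3$ on every vertex with in-degree or out-degree greater than 3; (2) convert to an undirected graph by replacing each vertex $v$ by $a_v,b_v,c_v$ with edges $\{a_v,b_v\},\{b_v,c_v\}$ and adding $\{c_u,a_v\}$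 for each arc $(u,v)$; (3) replace each degree-4 vertex by a copy of the 4-gate, joining its four former neighbours bijectively to the attachment vertices $1,2,9,11$; (4) if some vertex has degree 1, output the Petersen graph; otherwise replace each degree-2 vertex with neighbours $u,w$ by a diamond: new vertices $x,y,z,t$ with edges $\{x,y\},\{x,z\},\{y,z\},\{y,t\},\{z,t\},\{u,x\},\{t,w\}$. -}

module Defs where

open import Data.Nat using (ℕ; zero; suc; _+_; _*_; _≤_; _<_; _≡ᵇ_; _<ᵇ_)
open import Data.Bool using (Bool; true; false; if_then_else_; not; _∨_; _∧_)
open import Data.Product using (Σ; Σ-syntax; _×_; _,_; proj₁; proj₂)
open import Data.List using (List; []; _∷_; _++_; map; filterᵇ; length; concatMap)
open import Data.Nat.ListAction using (sum)
open import Data.Bool.ListAction using (any)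
open import Data.List.Membership.Propositional using (_∈_; _∉_)
open import Data.List.Relation.Unary.All using (All)
open import Data.List.Relation.Unary.Unique.Propositional using (Unique)
open import Data.List.Relation.Binary.Permutation.Propositional using (_↭_)
open import Data.Vec using (Vec; lookup; toList)
open import Data.Fin using (Fin)
open import Relation.Binary.PropositionalEquality using (_≡_; _≢_)

-- Directed graphs: vertices labelled by natural numbers, arcs as pairs
-- (tail , head).

record Digraph : Set where
  constructor digraph
  field
    V : List ℕ
    A : List (ℕ × ℕ)
open Digraph public

IsDigraph : Digraph → Set
IsDigraph G =
  Unique (V G) × Unique (A G) ×
  All (λ a → proj₁ a ≢ proj₂ a × proj₁ a ∈ V G × proj₂ a ∈ V G) (A G)

indeg : Digraph → ℕ → ℕ
indeg G w = length (filterᵇ (λ a → proj₂ a ≡ᵇ w) (A G))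

outdeg : Digraph → ℕ → ℕ
outdeg G w = length (filterᵇ (λ a → proj₁ a ≡ᵇ w) (A G))

inNbrs : Digraph → ℕ → List ℕ
inNbrs G w = map proj₁ (filterᵇ (λ a → proj₂ a ≡ᵇ w) (A G))

outNbrs : Digraph → ℕ → List ℕ
outNbrs G w = map proj₂ (filterᵇ (λ a → proj₁ a ≡ᵇ w) (A G))

degSum : Digraph → ℕ
degSum G = sum (map (λ v → indeg G v + outdeg G v) (V G))

removeL : ℕ → List ℕ → List ℕ
removeL w = filterᵇ (λ x → not (x ≡ᵇ w))

Fresh2 : List ℕ → ℕ → ℕ → Set
Fresh2 Vs p q = p ∉ Vs × q ∉ Vs × p ≢ q

Fresh3 : List ℕ → ℕ → ℕ → ℕ → Set
Fresh3 Vs p q t = p ∉ Vs × q ∉ Vs × t ∉ Vs × p ≢ q × p ≢ t × q ≢ t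

Balanced : ℕ → ℕ → Set
Balanced m n = m ≤ suc n × n ≤ suc m

BalancedChoice : (ℕ → Bool) → List ℕ → Set
BalancedChoice f xs = Balanced (length (filterᵇ f xs)) (length (filterᵇ (λ x → not (f x)) xs))

split : Digraph → ℕ → ℕ → ℕ → Digraph
split G w p q = digraph
  (removeL w (V G) ++ p ∷ q ∷ [])
  (map (λ a → (if proj₁ a ≡ᵇ w then q else proj₁ a) , (if proj₂ a ≡ᵇ w then p else proj₂ a)) (A G)
    ++ (p , q) ∷ [])

inSplit : Digraph → ℕ → ℕ → ℕ → ℕ → (ℕ → Bool) → Digraph
inSplit G w p q t f = digraph
  (removeL w (V G) ++ p ∷ q ∷ t ∷ [])
  (map (λ a → (if proj₁ a ≡ᵇ w then t else proj₁ a)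
            , (if proj₂ a ≡ᵇ w then (if f (proj₁ a) then p else q) else proj₂ a)) (A G)
    ++ (p , q) ∷ (q , p) ∷ (p , t) ∷ (q , t) ∷ [])

outSplit : Digraph → ℕ → ℕ → ℕ → ℕ → (ℕ → Bool) → Digraph
outSplit G w p q t g = digraph
  (removeL w (V G) ++ p ∷ q ∷ t ∷ [])
  (map (λ a → (if proj₁ a ≡ᵇ w then (if g (proj₂ a) then q else t) else proj₁ a)
            , (if proj₂ a ≡ᵇ w then p else proj₂ a)) (A G)
    ++ (p , q) ∷ (p , t) ∷ (q , t) ∷ (t , q) ∷ [])

-- The Splitting Procedure with parameter d.  R is the current vertex set
-- of the replacing subgraph.

data InPhase (d : ℕ) : Digraph → List ℕ → Digraph → List ℕ → Set where
  stop : ∀ {G R} → (∀ r → r ∈ R → indeg G r ≤ d) → InPhase d G R G R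
  step : ∀ {G R G' R'} w p q t (f : ℕ → Bool) →
         w ∈ R → d < indeg G w → Fresh3 (V G) p q t → BalancedChoice f (inNbrs G w) →
         InPhase d (inSplit G w p q t f) (removeL w R ++ p ∷ q ∷ t ∷ []) G' R' →
         InPhase d G R G' R'

data OutPhase (d : ℕ) : Digraph → List ℕ → Digraph → List ℕ → Set where
  stop : ∀ {G R} → (∀ r → r ∈ R → outdeg G r ≤ d) → OutPhase d G R G R
  step : ∀ {G R G' R'} w p q t (g : ℕ → Bool) →
         w ∈ R → d < outdeg G w → Fresh3 (V G) p q t → BalancedChoice g (outNbrs G w) →
         OutPhase d (outSplit G w p q t g) (removeL w R ++ p ∷ q ∷ t ∷ []) G' R' →
         OutPhase d G R G' R'

SplittingProcedure : ℕ → ℕ → Digraph → Digraph → Set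
SplittingProcedure d v G G' =
  Σ[ p ∈ ℕ ] Σ[ q ∈ ℕ ] Σ[ G₁ ∈ Digraph ] Σ[ R₁ ∈ List ℕ ] Σ[ R₂ ∈ List ℕ ]
    Fresh2 (V G) p q ×
    InPhase d (split G v p q) (p ∷ q ∷ []) G₁ R₁ ×
    OutPhase d G₁ R₁ G' R₂

data SplitAll : Digraph → List ℕ → Digraph → Set where
  done : ∀ {G} → SplitAll G [] G
  next : ∀ {G G₁ G₂ v vs} → SplittingProcedure 3 v G G₁ → SplitAll G₁ vs G₂ →
         SplitAll G (v ∷ vs) G₂

bigVertices : Digraph → List ℕ
bigVertices G = filterᵇ (λ v → (3 <ᵇ indeg G v) ∨ (3 <ᵇ outdeg G v)) (V G)

Step1 : Digraph → Digraph → Set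
Step1 Γ G = Σ[ order ∈ List ℕ ] order ↭ bigVertices Γ × SplitAll Γ order G

-- Undirected graphs: vertex labels and edges as (unordered) pairs

record UGraph : Set where
  constructor ugraph
  field
    UV : List ℕ
    UE : List (ℕ × ℕ)
open UGraph public

incident : ℕ → ℕ × ℕ → Bool
incident x e = (proj₁ e ≡ᵇ x) ∨ (proj₂ e ≡ᵇ x)

udeg : UGraph → ℕ → ℕ
udeg H x = length (filterᵇ (incident x) (UE H))

nbrs : UGraph → ℕ → List ℕ
nbrs H x = concatMap (λ e → (if proj₁ e ≡ᵇ x then proj₂ e ∷ [] else [])
                          ++ (if proj₂ e ≡ᵇ x then proj₁ e ∷ [] else [])) (UE H)

aV bV cV : ℕ → ℕ
aV v = 3 * v
bV v = 3 * v + 1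
cV v = 3 * v + 2

toUndirected : Digraph → UGraph
toUndirected G = ugraph
  (concatMap (λ v → aV v ∷ bV v ∷ cV v ∷ []) (V G))
  (concatMap (λ v → (aV v , bV v) ∷ (bV v , cV v) ∷ []) (V G)
    ++ map (λ a → cV (proj₁ a) , aV (proj₂ a)) (A G))

-- Step (3): the 4-gate.  Gate vertex i (1..11) is index i-1 of Fin 11.

gateEdges : List (Fin 11 × Fin 11)
gateEdges =
  (# 0 , # 2) ∷ (# 0 , # 7) ∷ (# 1 , # 2) ∷ (# 1 , # 4) ∷ (# 2 , # 3) ∷
  (# 3 , # 4) ∷ (# 3 , # 5) ∷ (# 5 , # 6) ∷ (# 6 , # 7) ∷ (# 6 , # 9) ∷
  (# 7 , # 8) ∷ (# 8 , # 9) ∷ (# 9 , # 10) ∷ (# 4 , # 10) ∷ []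
  where open import Data.Fin using (#_)

-- replace x by a copy of the gate with vertex labels gs, joining the
-- former neighbours n₁ n₂ n₃ n₄ to the attachment vertices 1, 2, 9, 11
gateReplace : UGraph → ℕ → Vec ℕ 11 → ℕ → ℕ → ℕ → ℕ → UGraph
gateReplace H x gs n₁ n₂ n₃ n₄ = ugraph
  (removeL x (UV H) ++ toList gs)
  (filterᵇ (λ e → not (incident x e)) (UE H)
    ++ map (λ e → lookup gs (proj₁ e) , lookup gs (proj₂ e)) gateEdges
    ++ (n₁ , lookup gs (# 0)) ∷ (n₂ , lookup gs (# 1)) ∷ (n₃ , lookup gs (# 8))
       ∷ (n₄ , lookup gs (# 10)) ∷ [])
  where open import Data.Fin using (#_)

-- one gate replacement at x: fresh labels, and a bijection from the four
-- neighbours to the attachment vertices (an ordering of the neighbours)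
GateStep : UGraph → ℕ → UGraph → Set
GateStep H x H' =
  Σ[ gs ∈ Vec ℕ 11 ] Σ[ n₁ ∈ ℕ ] Σ[ n₂ ∈ ℕ ] Σ[ n₃ ∈ ℕ ] Σ[ n₄ ∈ ℕ ]
    Unique (toList gs) × All (λ y → y ∉ UV H) (toList gs) ×
    (n₁ ∷ n₂ ∷ n₃ ∷ n₄ ∷ []) ↭ nbrs H x ×
    H' ≡ gateReplace H x gs n₁ n₂ n₃ n₄

data GateAll : UGraph → List ℕ → UGraph → Set where
  done : ∀ {H} → GateAll H [] H
  next : ∀ {H H₁ H₂ x xs} → GateStep H x H₁ → GateAll H₁ xs H₂ → GateAll H (x ∷ xs) H₂

verticesOfDeg : ℕ → UGraph → List ℕ
verticesOfDeg n H = filterᵇ (λ x → udeg H x ≡ᵇ n) (UV H)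

Step3 : UGraph → UGraph → Set
Step3 H H' = Σ[ order ∈ List ℕ ] order ↭ verticesOfDeg 4 H × GateAll H order H'

diamond : UGraph → ℕ → ℕ → ℕ → ℕ → ℕ → ℕ → ℕ → UGraph
diamond H s u w x y z t = ugraph
  (removeL s (UV H) ++ x ∷ y ∷ z ∷ t ∷ [])
  (filterᵇ (λ e → not (incident s e)) (UE H)
    ++ (x , y) ∷ (x , z) ∷ (y , z) ∷ (y , t) ∷ (z , t) ∷ (u , x) ∷ (t , w) ∷ [])

DiamondStep : UGraph → ℕ → UGraph → Set
DiamondStep H s H' =
  Σ[ u ∈ ℕ ] Σ[ w ∈ ℕ ] Σ[ x ∈ ℕ ] Σ[ y ∈ ℕ ] Σ[ z ∈ ℕ ] Σ[ t ∈ ℕ ]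
    Unique (x ∷ y ∷ z ∷ t ∷ []) × All (λ r → r ∉ UV H) (x ∷ y ∷ z ∷ t ∷ []) ×
    (u ∷ w ∷ []) ↭ nbrs H s ×
    H' ≡ diamond H s u w x y z t

data DiamondAll : UGraph → List ℕ → UGraph → Set where
  done : ∀ {H} → DiamondAll H [] H
  next : ∀ {H H₁ H₂ s ss} → DiamondStep H s H₁ → DiamondAll H₁ ss H₂ →
         DiamondAll H (s ∷ ss) H₂

petersen : UGraph
petersen = ugraph
  (0 ∷ 1 ∷ 2 ∷ 3 ∷ 4 ∷ 5 ∷ 6 ∷ 7 ∷ 8 ∷ 9 ∷ [])
  ((0 , 1) ∷ (1 , 2) ∷ (2 , 3) ∷ (3 , 4) ∷ (4 , 0) ∷
   (0 , 5) ∷ (1 , 6) ∷ (2 , 7) ∷ (3 , 8) ∷ (4 , 9) ∷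
   (5 , 7) ∷ (7 , 9) ∷ (9 , 6) ∷ (6 , 8) ∷ (8 , 5) ∷ [])

hasDeg1 : UGraph → Bool
hasDeg1 H = any (λ x → udeg H x ≡ᵇ 1) (UV H)

Step4 : UGraph → UGraph → Set
Step4 H H' with hasDeg1 H
... | true  = H' ≡ petersen
... | false = Σ[ order ∈ List ℕ ] order ↭ verticesOfDeg 2 H × DiamondAll H order H'

QuickConversion : Digraph → UGraph → Set
QuickConversion Γ H =
  Σ[ G₁ ∈ Digraph ] Σ[ H₃ ∈ UGraph ]
    Step1 Γ G₁ × Step3 (toUndirected G₁) H₃ × Step4 H₃ H

-- The proof is a potential argument.  A vertex of in-degree i and
-- out-degree o gets the potential φ i o = P i + P o + 4 (0 if isolated),
-- where P d bounds the number of output vertices that an endpoint a_v or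
-- c_v of degree d + 1 gives rise to in steps (2)–(4); Φ G sums φ over G.
--  * Step (1).
--    A split raises Φ by at most 18; in- and out-splits of a vertex of
--    degree above 3 leave Φ unchanged, because P is additive across
--    balanced divisions.  Paying 18 per split vertex out of 25 per unit of
--    degree (lemma budget) gives Φ G₁ ≤ 25k.
--  * Steps (2)–(4).  The size of the output is a sum, over the vertices of
--    G₁, of the contributions of a_v, b_v, c_v and of the gates and
--    diamonds replacing them; each is at most φ, provided every vertex of
--    G₁ has an incoming arc.  Otherwise some a_v keeps degree 1 and the
--    output is the Petersen graph, whose 10 vertices are at most 25k.
module Submission where

open import Defs
open import Data.Nat using (ℕ; zero; suc; _+_; _*_; _≤_; _<_; _≡ᵇ_; _<ᵇ_; z≤n; s≤s; _≤?_)
open import Data.Nat.Properties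
open import Data.Nat.DivMod using (_%_; [m+kn]%n≡m%n; m<n⇒m%n≡m)
open import Data.Nat.ListAction using (sum)
open import Data.Nat.ListAction.Properties using (sum-++; sum-↭)
open import Data.Nat.Tactic.RingSolver using (solve-∀)
open import Data.Bool using (Bool; true; false; if_then_else_; not; _∨_; _∧_; T; T?)
open import Data.Bool.ListAction using (any)
open import Data.Bool.Properties using (∧-identityʳ; ∧-zeroʳ; ∨-identityʳ; ∨-zeroʳ)
open import Data.Unit using (tt)
open import Data.Empty using (⊥-elim)
open import Data.Sum using (_⊎_; inj₁; inj₂)
open import Data.Product using (Σ-syntax; _×_; _,_; proj₁; proj₂)
open import Data.List using (List; []; _∷_; _++_; map; filterᵇ; length; concatMap)
open import Data.List.Properties using (map-++; map-∘; length-map; length-++)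
open import Data.List.Membership.Propositional using (_∈_; _∉_)
open import Data.List.Membership.DecPropositional _≟_ using (_∈?_)
open import Data.List.Membership.Propositional.Properties
  using (∈-filter⁺; ∈-filter⁻; ∈-++⁻; ∈-++⁺ˡ; ∈-++⁺ʳ; ∈-map⁻)
open import Data.List.Relation.Unary.Any using (here; there)
open import Data.List.Relation.Unary.All using (All; []; _∷_; tabulate) renaming (lookup to All-lookup; map to All-map)
open import Data.List.Relation.Unary.All.Properties using () renaming (++⁺ to All-++⁺; map⁺ to All-map⁺)
open import Data.List.Relation.Unary.AllPairs using ([]; _∷_)
open import Data.List.Relation.Unary.Unique.Propositional using (Unique)
import Data.List.Relation.Unary.Unique.Propositional.Properties as Unique
open import Data.List.Relation.Binary.Permutation.Propositional using (_↭_; ↭-sym; ↭⇒↭ₛ)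
import Data.List.Relation.Binary.Permutation.Setoid.Properties
open import Data.List.Relation.Binary.Permutation.Propositional.Properties
  using (∈-resp-↭; ↭-length) renaming (map⁺ to ↭-map⁺)
open import Data.Vec using (Vec; lookup; toList) renaming ([] to []ᵛ; _∷_ to _∷ᵛ_)
open import Data.Vec.Properties using (length-toList)
open import Data.Vec.Membership.Propositional.Properties using (∈-lookup; ∈-toList⁺)
import Data.Fin as Fin
open import Data.Fin using (Fin; toℕ; #_)
open import Data.Fin.Properties using (toℕ-injective) renaming (_≟_ to _≟ᶠ_)
open import Relation.Binary.PropositionalEquality
open import Relation.Nullary using (¬_; yes; no; contradiction)
open import Relation.Nullary.Decidable using (True; toWitness)

𝟙 : Bool → ℕ
𝟙 true = 1
𝟙 false = 0

≡ᵇ-refl : ∀ n → (n ≡ᵇ n) ≡ true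
≡ᵇ-refl zero = refl
≡ᵇ-refl (suc n) = ≡ᵇ-refl n

≢⇒≡ᵇ-false : ∀ {m n} → m ≢ n → (m ≡ᵇ n) ≡ false
≢⇒≡ᵇ-false {m} {n} m≢n with m ≡ᵇ n in eq
... | true = ⊥-elim (m≢n (≡ᵇ⇒≡ m n (subst T (sym eq) tt)))
... | false = refl

≡ᵇ-false⇒≢ : ∀ {m n} → (m ≡ᵇ n) ≡ false → m ≢ n
≡ᵇ-false⇒≢ {m} eq refl with () ← trans (sym (≡ᵇ-refl m)) eq

≡ᵇ-view : ∀ m n → (m ≡ n × (m ≡ᵇ n) ≡ true) ⊎ (m ≢ n × (m ≡ᵇ n) ≡ false)
≡ᵇ-view m n with m ≟ n
... | yes refl = inj₁ (refl , ≡ᵇ-refl m)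
... | no m≢n = inj₂ (m≢n , ≢⇒≡ᵇ-false m≢n)

∈⇒≢ : ∀ {x y : ℕ} {xs} → x ∈ xs → y ∉ xs → x ≢ y
∈⇒≢ x∈ y∉ refl = y∉ x∈

by-evaluation : ∀ {m n} {check : True (m ≤? n)} → m ≤ n
by-evaluation {check = check} = toWitness check

sumBy : {X : Set} → (X → ℕ) → List X → ℕ
sumBy f xs = sum (map f xs)

count : {X : Set} → (X → Bool) → List X → ℕ
count p xs = length (filterᵇ p xs)

module _ {X : Set} where

  count-as-sum : (p : X → Bool) (xs : List X) → count p xs ≡ sumBy (λ x → 𝟙 (p x)) xs
  count-as-sum p [] = refl
  count-as-sum p (x ∷ xs) with p x
  ... | true = cong suc (count-as-sum p xs)
  ... | false = count-as-sum p xs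

  length-as-sum : (xs : List X) → length xs ≡ sumBy (λ _ → 1) xs
  length-as-sum [] = refl
  length-as-sum (x ∷ xs) = cong suc (length-as-sum xs)

  sumBy-++ : (f : X → ℕ) (xs ys : List X) → sumBy f (xs ++ ys) ≡ sumBy f xs + sumBy f ys
  sumBy-++ f xs ys = trans (cong sum (map-++ f xs ys)) (sum-++ (map f xs) (map f ys))

  sumBy-cong : {f g : X → ℕ} (xs : List X) → (∀ x → x ∈ xs → f x ≡ g x) → sumBy f xs ≡ sumBy g xs
  sumBy-cong [] _ = refl
  sumBy-cong (x ∷ xs) f≡g = cong₂ _+_ (f≡g x (here refl)) (sumBy-cong xs (λ y y∈ → f≡g y (there y∈)))

  sumBy-mono : {f g : X → ℕ} (xs : List X) → (∀ x → x ∈ xs → f x ≤ g x) → sumBy f xs ≤ sumBy g xs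
  sumBy-mono [] _ = z≤n
  sumBy-mono (x ∷ xs) f≤g = +-mono-≤ (f≤g x (here refl)) (sumBy-mono xs (λ y y∈ → f≤g y (there y∈)))

  sumBy-zero : {f : X → ℕ} (xs : List X) → (∀ x → x ∈ xs → f x ≡ 0) → sumBy f xs ≡ 0
  sumBy-zero [] _ = refl
  sumBy-zero (x ∷ xs) f≡0 = cong₂ _+_ (f≡0 x (here refl)) (sumBy-zero xs (λ y y∈ → f≡0 y (there y∈)))

  sumBy-+ : (f g : X → ℕ) (xs : List X) → sumBy (λ x → f x + g x) xs ≡ sumBy f xs + sumBy g xs
  sumBy-+ f g [] = refl
  sumBy-+ f g (x ∷ xs) rewrite sumBy-+ f g xs = interchange (f x) (g x) (sumBy f xs) (sumBy g xs)
    where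
    interchange : ∀ a b c d → a + b + (c + d) ≡ a + c + (b + d)
    interchange = solve-∀

  sumBy-* : (k : ℕ) (f : X → ℕ) (xs : List X) → sumBy (λ x → k * f x) xs ≡ k * sumBy f xs
  sumBy-* k f [] = sym (*-zeroʳ k)
  sumBy-* k f (x ∷ xs) rewrite sumBy-* k f xs = sym (*-distribˡ-+ k (f x) (sumBy f xs))

  sumBy-member : (f : X → ℕ) {x : X} {xs : List X} → x ∈ xs → f x ≤ sumBy f xs
  sumBy-member f {xs = y ∷ ys} (here refl) = m≤m+n (f y) _
  sumBy-member f {xs = y ∷ ys} (there x∈) = ≤-trans (sumBy-member f x∈) (m≤n+m _ (f y))

  sumBy-↭ : (f : X → ℕ) {xs ys : List X} → xs ↭ ys → sumBy f xs ≡ sumBy f ys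
  sumBy-↭ f xs↭ys = sum-↭ (↭-map⁺ f xs↭ys)

  sumBy-filter : (h s : X → Bool) (xs : List X) →
    sumBy (λ x → 𝟙 (s x)) (filterᵇ h xs) ≡ sumBy (λ x → 𝟙 (h x ∧ s x)) xs
  sumBy-filter h s [] = refl
  sumBy-filter h s (x ∷ xs) with h x
  ... | true = cong (𝟙 (s x) +_) (sumBy-filter h s xs)
  ... | false = sumBy-filter h s xs

  count-partition : (p : X → Bool) (xs : List X) → count p xs + count (λ x → not (p x)) xs ≡ length xs
  count-partition p [] = refl
  count-partition p (x ∷ xs) with p x
  ... | true = cong suc (count-partition p xs)
  ... | false = trans (+-suc _ _) (cong suc (count-partition p xs))

  count-true : (xs : List X) → count (λ _ → true) xs ≡ length xs
  count-true [] = refl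
  count-true (x ∷ xs) = cong suc (count-true xs)

  count-false : (xs : List X) → count (λ _ → false) xs ≡ 0
  count-false [] = refl
  count-false (x ∷ xs) = count-false xs

  sumBy-filter-≤ : (h : X → Bool) (f : X → ℕ) (xs : List X) → sumBy f (filterᵇ h xs) ≤ sumBy f xs
  sumBy-filter-≤ h f [] = z≤n
  sumBy-filter-≤ h f (x ∷ xs) with h x
  ... | true = +-monoʳ-≤ (f x) (sumBy-filter-≤ h f xs)
  ... | false = ≤-trans (sumBy-filter-≤ h f xs) (m≤n+m _ (f x))

module _ {X Y : Set} where

  sumBy-map : (f : Y → ℕ) (g : X → Y) (xs : List X) → sumBy f (map g xs) ≡ sumBy (λ x → f (g x)) xs
  sumBy-map f g xs = cong sum (sym (map-∘ xs))

  sumBy-concatMap : (f : Y → ℕ) (g : X → List Y) (xs : List X) →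
    sumBy f (concatMap g xs) ≡ sumBy (λ x → sumBy f (g x)) xs
  sumBy-concatMap f g [] = refl
  sumBy-concatMap f g (x ∷ xs) = trans (sumBy-++ f (g x) (concatMap g xs)) (cong (sumBy f (g x) +_) (sumBy-concatMap f g xs))

  ∈-concatMap⁺ : {g : X → List Y} {x : X} {y : Y} (xs : List X) → x ∈ xs → y ∈ g x → y ∈ concatMap g xs
  ∈-concatMap⁺ {g} (x ∷ xs) (here refl) y∈ = ∈-++⁺ˡ y∈
  ∈-concatMap⁺ {g} (x ∷ xs) (there x∈) y∈ = ∈-++⁺ʳ (g x) (∈-concatMap⁺ xs x∈ y∈)

  ∈-concatMap⁻ : {g : X → List Y} {y : Y} (xs : List X) → y ∈ concatMap g xs → Σ[ x ∈ X ] (x ∈ xs × y ∈ g x)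
  ∈-concatMap⁻ {g} (x ∷ xs) y∈ with ∈-++⁻ (g x) y∈
  ... | inj₁ y∈gx = x , here refl , y∈gx
  ... | inj₂ y∈rest with ∈-concatMap⁻ xs y∈rest
  ... | x' , x'∈ , y∈gx' = x' , there x'∈ , y∈gx'

∈-filterᵇ⁺ : {X : Set} (p : X → Bool) {x : X} {xs : List X} → x ∈ xs → T (p x) → x ∈ filterᵇ p xs
∈-filterᵇ⁺ p = ∈-filter⁺ (λ x → T? (p x))

∈-filterᵇ⁻ : {X : Set} (p : X → Bool) {x : X} {xs : List X} → x ∈ filterᵇ p xs → x ∈ xs × T (p x)
∈-filterᵇ⁻ p {xs = xs} = ∈-filter⁻ (λ x → T? (p x)) {xs = xs}

∈-removeL⁺ : ∀ {y w xs} → y ∈ xs → y ≢ w → y ∈ removeL w xs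
∈-removeL⁺ {y} {w} y∈ y≢w = ∈-filterᵇ⁺ (λ x → not (x ≡ᵇ w)) y∈ (subst (λ b → T (not b)) (sym (≢⇒≡ᵇ-false y≢w)) tt)

∈-removeL⁻ : ∀ {y w xs} → y ∈ removeL w xs → y ∈ xs × y ≢ w
∈-removeL⁻ {y} {w} {xs} y∈ with ∈-filterᵇ⁻ (λ x → not (x ≡ᵇ w)) {xs = xs} y∈
... | y∈xs , kept = y∈xs , λ { refl → subst (λ b → T (not b)) (≡ᵇ-refl w) kept }

removeL-∉ : ∀ w xs → w ∉ xs → removeL w xs ≡ xs
removeL-∉ w [] _ = refl
removeL-∉ w (x ∷ xs) w∉ rewrite ≢⇒≡ᵇ-false {x} {w} (λ { refl → w∉ (here refl) }) =
  cong (x ∷_) (removeL-∉ w xs (λ w∈ → w∉ (there w∈)))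

sumBy-removeL : (f : ℕ → ℕ) {w : ℕ} {xs : List ℕ} → Unique xs → w ∈ xs →
  sumBy f xs ≡ f w + sumBy f (removeL w xs)
sumBy-removeL f {xs = x ∷ xs} (x∉xs ∷ _) (here refl)
  rewrite ≡ᵇ-refl x | removeL-∉ x xs (λ x∈ → All-lookup x∉xs x∈ refl) = refl
sumBy-removeL f {w} {x ∷ xs} (x∉xs ∷ uniq) (there w∈) with ≡ᵇ-view x w
... | inj₁ (refl , _) = ⊥-elim (All-lookup x∉xs w∈ refl)
... | inj₂ (_ , x≢ᵇw) rewrite x≢ᵇw | sumBy-removeL f uniq w∈ =
  swap-front (f x) (f w) (sumBy f (removeL w xs))
  where
  swap-front : ∀ a b c → a + (b + c) ≡ b + (a + c)
  swap-front = solve-∀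

count-unique : ∀ {v xs} → Unique xs → v ∈ xs → sumBy (λ u → 𝟙 (u ≡ᵇ v)) xs ≡ 1
count-unique {v} {xs} uniq v∈ = begin
  sumBy (λ u → 𝟙 (u ≡ᵇ v)) xs                     ≡⟨ sumBy-removeL (λ u → 𝟙 (u ≡ᵇ v)) uniq v∈ ⟩
  𝟙 (v ≡ᵇ v) + sumBy (λ u → 𝟙 (u ≡ᵇ v)) (removeL v xs) ≡⟨ cong₂ _+_ (cong 𝟙 (≡ᵇ-refl v)) others ⟩
  1 + 0                                          ∎
  where
  open ≡-Reasoning
  others : sumBy (λ u → 𝟙 (u ≡ᵇ v)) (removeL v xs) ≡ 0
  others = sumBy-zero (removeL v xs) (λ u u∈ → cong 𝟙 (≢⇒≡ᵇ-false (proj₂ (∈-removeL⁻ {xs = xs} u∈))))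

length-removeL : ∀ {w xs} → w ∈ xs → suc (length (removeL w xs)) ≤ length xs
length-removeL {w} {xs} w∈ = begin
  suc (length (removeL w xs))              ≤⟨ +-monoˡ-≤ _ occurs ⟩
  count (_≡ᵇ w) xs + length (removeL w xs) ≡⟨ count-partition (_≡ᵇ w) xs ⟩
  length xs                                ∎
  where
  open ≤-Reasoning
  occurs : 1 ≤ count (_≡ᵇ w) xs
  occurs = ≤-trans (≤-reflexive (cong 𝟙 (sym (≡ᵇ-refl w))))
             (≤-trans (sumBy-member (λ x → 𝟙 (x ≡ᵇ w)) w∈) (≤-reflexive (sym (count-as-sum (_≡ᵇ w) xs))))

-- the invariant kept by every splitting operation: labels are distinct
-- and every arc joins two vertices of the graph
WellFormed : Digraph → Set
WellFormed G = Unique (V G) × All (λ a → proj₁ a ∈ V G × proj₂ a ∈ V G) (A G)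

tail∈ : ∀ {G a} → WellFormed G → a ∈ A G → proj₁ a ∈ V G
tail∈ wf a∈ = proj₁ (All-lookup (proj₂ wf) a∈)

head∈ : ∀ {G a} → WellFormed G → a ∈ A G → proj₂ a ∈ V G
head∈ wf a∈ = proj₂ (All-lookup (proj₂ wf) a∈)

indeg-as-sum : ∀ G y → indeg G y ≡ sumBy (λ a → 𝟙 (proj₂ a ≡ᵇ y)) (A G)
indeg-as-sum G y = count-as-sum (λ a → proj₂ a ≡ᵇ y) (A G)

outdeg-as-sum : ∀ G y → outdeg G y ≡ sumBy (λ a → 𝟙 (proj₁ a ≡ᵇ y)) (A G)
outdeg-as-sum G y = count-as-sum (λ a → proj₁ a ≡ᵇ y) (A G)

indeg-∉ : ∀ {G w} → WellFormed G → w ∉ V G → indeg G w ≡ 0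
indeg-∉ {G} {w} wf w∉ = trans (indeg-as-sum G w)
  (sumBy-zero (A G) (λ a a∈ → cong 𝟙 (≢⇒≡ᵇ-false (∈⇒≢ (head∈ {G} wf a∈) w∉))))

outdeg-∉ : ∀ {G w} → WellFormed G → w ∉ V G → outdeg G w ≡ 0
outdeg-∉ {G} {w} wf w∉ = trans (outdeg-as-sum G w)
  (sumBy-zero (A G) (λ a a∈ → cong 𝟙 (≢⇒≡ᵇ-false (∈⇒≢ (tail∈ {G} wf a∈) w∉))))

count-inNbrs : ∀ G w (s : ℕ → Bool) →
  count s (inNbrs G w) ≡ sumBy (λ a → 𝟙 ((proj₂ a ≡ᵇ w) ∧ s (proj₁ a))) (A G)
count-inNbrs G w s = begin
  count s (inNbrs G w)                                              ≡⟨ count-as-sum s (inNbrs G w) ⟩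
  sumBy (λ x → 𝟙 (s x)) (map proj₁ (filterᵇ (λ a → proj₂ a ≡ᵇ w) (A G))) ≡⟨ sumBy-map (λ x → 𝟙 (s x)) proj₁ (filterᵇ (λ a → proj₂ a ≡ᵇ w) (A G)) ⟩
  sumBy (λ a → 𝟙 (s (proj₁ a))) (filterᵇ (λ a → proj₂ a ≡ᵇ w) (A G))  ≡⟨ sumBy-filter _ _ (A G) ⟩
  sumBy (λ a → 𝟙 ((proj₂ a ≡ᵇ w) ∧ s (proj₁ a))) (A G)             ∎
  where open ≡-Reasoning

count-outNbrs : ∀ G w (s : ℕ → Bool) →
  count s (outNbrs G w) ≡ sumBy (λ a → 𝟙 ((proj₁ a ≡ᵇ w) ∧ s (proj₂ a))) (A G)
count-outNbrs G w s = begin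
  count s (outNbrs G w)                                             ≡⟨ count-as-sum s (outNbrs G w) ⟩
  sumBy (λ x → 𝟙 (s x)) (map proj₂ (filterᵇ (λ a → proj₁ a ≡ᵇ w) (A G))) ≡⟨ sumBy-map (λ x → 𝟙 (s x)) proj₂ (filterᵇ (λ a → proj₁ a ≡ᵇ w) (A G)) ⟩
  sumBy (λ a → 𝟙 (s (proj₂ a))) (filterᵇ (λ a → proj₁ a ≡ᵇ w) (A G))  ≡⟨ sumBy-filter _ _ (A G) ⟩
  sumBy (λ a → 𝟙 ((proj₁ a ≡ᵇ w) ∧ s (proj₂ a))) (A G)             ∎
  where open ≡-Reasoning

length-inNbrs : ∀ G w → length (inNbrs G w) ≡ indeg G w
length-inNbrs G w = length-map proj₁ (filterᵇ (λ a → proj₂ a ≡ᵇ w) (A G))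

length-outNbrs : ∀ G w → length (outNbrs G w) ≡ outdeg G w
length-outNbrs G w = length-map proj₂ (filterᵇ (λ a → proj₁ a ≡ᵇ w) (A G))

-- Rewiring: the common shape of split, in-split and out-split.

redirect : ℕ → ℕ → ℕ → ℕ
redirect w r c = if c ≡ᵇ w then r else c

rewire : Digraph → ℕ → List ℕ → (ℕ × ℕ → ℕ) → (ℕ × ℕ → ℕ) → List (ℕ × ℕ) → Digraph
rewire G w news τ η ex = digraph
  (removeL w (V G) ++ news)
  (map (λ a → redirect w (τ a) (proj₁ a) , redirect w (η a) (proj₂ a)) (A G) ++ ex)

redirect-other : ∀ c w r y → r ≢ y → y ≢ w → (redirect w r c ≡ᵇ y) ≡ (c ≡ᵇ y)
redirect-other c w r y r≢y y≢w with ≡ᵇ-view c w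
... | inj₁ (refl , c≡ᵇw) rewrite c≡ᵇw = trans (≢⇒≡ᵇ-false r≢y) (sym (≢⇒≡ᵇ-false {c} {y} (λ { refl → y≢w refl })))
... | inj₂ (_ , c≢ᵇw) rewrite c≢ᵇw = refl

redirect-new : ∀ c w r z → c ≢ z → (redirect w r c ≡ᵇ z) ≡ ((c ≡ᵇ w) ∧ (r ≡ᵇ z))
redirect-new c w r z c≢z with ≡ᵇ-view c w
... | inj₁ (_ , c≡ᵇw) rewrite c≡ᵇw = refl
... | inj₂ (_ , c≢ᵇw) rewrite c≢ᵇw = ≢⇒≡ᵇ-false c≢z

weight : (ℕ → ℕ → ℕ) → Digraph → List ℕ → ℕ
weight c G xs = sumBy (λ v → c (indeg G v) (outdeg G v)) xs

module Rewiring (G : Digraph) (wf : WellFormed G) (w : ℕ) (news : List ℕ)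
                (τ η : ℕ × ℕ → ℕ) (ex : List (ℕ × ℕ))
                (fresh : All (_∉ V G) news) (τ∈ : ∀ a → τ a ∈ news) (η∈ : ∀ a → η a ∈ news)
                (ex∈ : All (λ e → proj₁ e ∈ news × proj₂ e ∈ news) ex) where

  G′ : Digraph
  G′ = rewire G w news τ η ex

  private
    new≢old : ∀ {z y} → z ∈ news → y ∈ V G → z ≢ y
    new≢old z∈ y∈ refl = All-lookup fresh z∈ y∈

    arcs-split : ∀ (end : ℕ × ℕ → ℕ) y →
      sumBy (λ a → 𝟙 (end a ≡ᵇ y)) (A G′) ≡
      sumBy (λ a → 𝟙 (end (redirect w (τ a) (proj₁ a) , redirect w (η a) (proj₂ a)) ≡ᵇ y)) (A G)
        + sumBy (λ a → 𝟙 (end a ≡ᵇ y)) ex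
    arcs-split end y = trans (sumBy-++ _ (map _ (A G)) ex) (cong (_+ _) (sumBy-map _ _ (A G)))

    ex-misses : ∀ (end : ℕ × ℕ → ℕ) → (∀ {e} → e ∈ ex → end e ∈ news) →
      ∀ {y} → y ∈ V G → sumBy (λ a → 𝟙 (end a ≡ᵇ y)) ex ≡ 0
    ex-misses end end∈ y∈ = sumBy-zero ex (λ e e∈ → cong 𝟙 (≢⇒≡ᵇ-false (new≢old (end∈ e∈) y∈)))

  indeg-old : ∀ y → y ∈ V G → y ≢ w → indeg G′ y ≡ indeg G y
  indeg-old y y∈ y≢w = begin
    indeg G′ y  ≡⟨ trans (indeg-as-sum G′ y) (arcs-split proj₂ y) ⟩
    _           ≡⟨ cong₂ _+_ (sumBy-cong (A G) (λ a _ → cong 𝟙 (redirect-other (proj₂ a) w (η a) y (new≢old (η∈ a) y∈) y≢w)))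
                             (ex-misses proj₂ (λ e∈ → proj₂ (All-lookup ex∈ e∈)) y∈) ⟩
    _ + 0       ≡⟨ trans (+-identityʳ _) (sym (indeg-as-sum G y)) ⟩
    indeg G y   ∎
    where open ≡-Reasoning

  outdeg-old : ∀ y → y ∈ V G → y ≢ w → outdeg G′ y ≡ outdeg G y
  outdeg-old y y∈ y≢w = begin
    outdeg G′ y ≡⟨ trans (outdeg-as-sum G′ y) (arcs-split proj₁ y) ⟩
    _           ≡⟨ cong₂ _+_ (sumBy-cong (A G) (λ a _ → cong 𝟙 (redirect-other (proj₁ a) w (τ a) y (new≢old (τ∈ a) y∈) y≢w)))
                             (ex-misses proj₁ (λ e∈ → proj₁ (All-lookup ex∈ e∈)) y∈) ⟩
    _ + 0       ≡⟨ trans (+-identityʳ _) (sym (outdeg-as-sum G y)) ⟩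
    outdeg G y  ∎
    where open ≡-Reasoning

  indeg-new : ∀ z → z ∈ news → (s : ℕ → Bool) → (∀ a → (η a ≡ᵇ z) ≡ s (proj₁ a)) →
    indeg G′ z ≡ count s (inNbrs G w) + sumBy (λ e → 𝟙 (proj₂ e ≡ᵇ z)) ex
  indeg-new z z∈ s sel = begin
    indeg G′ z                                                       ≡⟨ trans (indeg-as-sum G′ z) (arcs-split proj₂ z) ⟩
    sumBy (λ a → 𝟙 (redirect w (η a) (proj₂ a) ≡ᵇ z)) (A G) + internal ≡⟨ cong (_+ internal) (sumBy-cong (A G) selected) ⟩
    sumBy (λ a → 𝟙 ((proj₂ a ≡ᵇ w) ∧ s (proj₁ a))) (A G) + internal    ≡⟨ cong (_+ internal) (sym (count-inNbrs G w s)) ⟩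
    count s (inNbrs G w) + internal                                  ∎
    where
    open ≡-Reasoning
    internal : ℕ
    internal = sumBy (λ e → 𝟙 (proj₂ e ≡ᵇ z)) ex
    selected : ∀ a → a ∈ A G → 𝟙 (redirect w (η a) (proj₂ a) ≡ᵇ z) ≡ 𝟙 ((proj₂ a ≡ᵇ w) ∧ s (proj₁ a))
    selected a a∈ = cong 𝟙 (trans (redirect-new (proj₂ a) w (η a) z (λ h → new≢old z∈ (head∈ {G} wf a∈) (sym h)))
                                  (cong ((proj₂ a ≡ᵇ w) ∧_) (sel a)))

  outdeg-new : ∀ z → z ∈ news → (s : ℕ → Bool) → (∀ a → (τ a ≡ᵇ z) ≡ s (proj₂ a)) →
    outdeg G′ z ≡ count s (outNbrs G w) + sumBy (λ e → 𝟙 (proj₁ e ≡ᵇ z)) ex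
  outdeg-new z z∈ s sel = begin
    outdeg G′ z                                                      ≡⟨ trans (outdeg-as-sum G′ z) (arcs-split proj₁ z) ⟩
    sumBy (λ a → 𝟙 (redirect w (τ a) (proj₁ a) ≡ᵇ z)) (A G) + internal ≡⟨ cong (_+ internal) (sumBy-cong (A G) selected) ⟩
    sumBy (λ a → 𝟙 ((proj₁ a ≡ᵇ w) ∧ s (proj₂ a))) (A G) + internal    ≡⟨ cong (_+ internal) (sym (count-outNbrs G w s)) ⟩
    count s (outNbrs G w) + internal                                 ∎
    where
    open ≡-Reasoning
    internal : ℕ
    internal = sumBy (λ e → 𝟙 (proj₁ e ≡ᵇ z)) ex
    selected : ∀ a → a ∈ A G → 𝟙 (redirect w (τ a) (proj₁ a) ≡ᵇ z) ≡ 𝟙 ((proj₁ a ≡ᵇ w) ∧ s (proj₂ a))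
    selected a a∈ = cong 𝟙 (trans (redirect-new (proj₁ a) w (τ a) z (λ h → new≢old z∈ (tail∈ {G} wf a∈) (sym h)))
                                  (cong ((proj₁ a ≡ᵇ w) ∧_) (sel a)))

  wellFormed : Unique news → WellFormed G′
  wellFormed uniq =
    Unique.++⁺ (Unique.filter⁺ _ (proj₁ wf)) uniq (λ { (old , new) → All-lookup fresh new (proj₁ (∈-removeL⁻ old)) }) ,
    All-++⁺ (All-map⁺ (tabulate (λ a∈ → redirected (tail∈ {G} wf a∈) (τ∈ _) , redirected (head∈ {G} wf a∈) (η∈ _))))
            (All-map (λ { (p∈ , q∈) → ∈-++⁺ʳ _ p∈ , ∈-++⁺ʳ _ q∈ }) ex∈)
    where
    redirected : ∀ {c r} → c ∈ V G → r ∈ news → redirect w r c ∈ V G′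
    redirected {c} c∈ r∈ with ≡ᵇ-view c w
    ... | inj₁ (_ , c≡ᵇw) rewrite c≡ᵇw = ∈-++⁺ʳ _ r∈
    ... | inj₂ (c≢w , c≢ᵇw) rewrite c≢ᵇw = ∈-++⁺ˡ (∈-removeL⁺ c∈ c≢w)

  weight-rewire : (c : ℕ → ℕ → ℕ) → c 0 0 ≡ 0 →
    weight c G′ (V G′) + c (indeg G w) (outdeg G w) ≡ weight c G′ news + weight c G (V G)
  weight-rewire c c00 = begin
    weight c G′ (V G′) + c (indeg G w) (outdeg G w)
      ≡⟨ cong (_+ _) (sumBy-++ _ (removeL w (V G)) news) ⟩
    weight c G′ (removeL w (V G)) + weight c G′ news + c (indeg G w) (outdeg G w)
      ≡⟨ cong (λ x → x + weight c G′ news + c (indeg G w) (outdeg G w)) (sumBy-cong (removeL w (V G)) (λ y y∈ →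
           let (y∈G , y≢w) = ∈-removeL⁻ y∈ in cong₂ c (indeg-old y y∈G y≢w) (outdeg-old y y∈G y≢w))) ⟩
    weight c G (removeL w (V G)) + weight c G′ news + c (indeg G w) (outdeg G w)
      ≡⟨ rearrange (weight c G (removeL w (V G))) _ _ ⟩
    weight c G′ news + (c (indeg G w) (outdeg G w) + weight c G (removeL w (V G)))
      ≡⟨ cong (weight c G′ news +_) (sym removal) ⟩
    weight c G′ news + weight c G (V G) ∎
    where
    open ≡-Reasoning
    rearrange : ∀ r n h → r + n + h ≡ n + (h + r)
    rearrange = solve-∀
    removal : weight c G (V G) ≡ c (indeg G w) (outdeg G w) + weight c G (removeL w (V G))
    removal with w ∈? V G
    ... | yes w∈ = sumBy-removeL _ (proj₁ wf) w∈
    ... | no w∉ rewrite indeg-∉ {G} wf w∉ | outdeg-∉ {G} wf w∉ | c00 | removeL-∉ w (V G) w∉ = refl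

  weight-bound : (c : ℕ → ℕ → ℕ) → c 0 0 ≡ 0 → (k : ℕ) →
    weight c G′ news ≤ c (indeg G w) (outdeg G w) + k → weight c G′ (V G′) ≤ k + weight c G (V G)
  weight-bound c c00 k new≤ = +-cancelʳ-≤ (c (indeg G w) (outdeg G w)) _ _ (begin
    weight c G′ (V G′) + c (indeg G w) (outdeg G w) ≡⟨ weight-rewire c c00 ⟩
    weight c G′ news + weight c G (V G)              ≤⟨ +-monoˡ-≤ _ new≤ ⟩
    c (indeg G w) (outdeg G w) + k + weight c G (V G) ≡⟨ rotate (c (indeg G w) (outdeg G w)) k _ ⟩
    k + weight c G (V G) + c (indeg G w) (outdeg G w) ∎)
    where
    open ≤-Reasoning
    rotate : ∀ h k y → h + k + y ≡ k + y + h
    rotate = solve-∀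

-- A vertex v of in-degree i and out-degree o of the
-- digraph fed to step (2) yields a_v, b_v, c_v of degrees i + 1, 2, o + 1,
-- and a vertex of degree 1, 2, 3, 4 finally accounts for at most 1, 4, 1,
-- 14 vertices (a diamond adds 3, a gate adds 10 and one diamond).  P
-- records this for i, o ≤ 3 and is extended linearly so that the
-- splittings pay for themselves.

P : ℕ → ℕ
P 0 = 1
P 1 = 4
P 2 = 1
P (suc (suc (suc n))) = 25 * n + 14

φ : ℕ → ℕ → ℕ
φ zero zero = 0
φ i o = P i + P o + 4

Φ : Digraph → ℕ
Φ G = weight φ G (V G)

φ-active-out : ∀ i o → 0 < o → φ i o ≡ P i + P o + 4
φ-active-out zero (suc o) _ = refl
φ-active-out (suc i) (suc o) _ = refl

φ-active-in : ∀ i o → 0 < i → φ i o ≡ P i + P o + 4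
φ-active-in (suc i) o _ = refl

split-cost : ∀ x y → x + 4 + 4 + (4 + y + 4 + 0) ≤ x + y + 4 + 18
split-cost x y = ≤-trans (≤-reflexive (regroup x y)) (+-monoʳ-≤ (x + y + 4) (m≤m+n 12 6))
  where
  regroup : ∀ x y → x + 4 + 4 + (4 + y + 4 + 0) ≡ x + y + 4 + 12
  regroup = solve-∀

φ-split : ∀ i o → φ i 1 + (φ 1 o + 0) ≤ φ i o + 18
φ-split zero zero = by-evaluation
φ-split zero (suc o) = split-cost (P 0) (P (suc o))
φ-split (suc i) o = split-cost (P (suc i)) (P o)

-- P is additive across a balanced division of a degree above 3: the two
-- halves plus the 11 vertices of the new gadget cost exactly the whole
P-balanced : ∀ a b → a ≤ suc b → b ≤ suc a → 4 ≤ a + b → P (suc a) + P (suc b) + 11 ≡ P (a + b)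
P-balanced zero b _ b≤1 4≤b with ≤-trans 4≤b b≤1
... | s≤s ()
P-balanced (suc zero) b _ b≤2 4≤1+b with ≤-trans 4≤1+b (s≤s b≤2)
... | s≤s (s≤s (s≤s ()))
P-balanced (suc (suc a)) zero (s≤s ()) _ _
P-balanced (suc (suc zero)) (suc zero) _ _ (s≤s (s≤s (s≤s ())))
P-balanced (suc (suc (suc a))) (suc zero) (s≤s (s≤s ())) _ _
P-balanced (suc (suc a)) (suc (suc b)) _ _ _ rewrite +-suc a (suc b) | +-suc a b = linear a b
  where
  linear : ∀ a b → 25 * a + 14 + (25 * b + 14) + 11 ≡ 25 * (1 + (a + b)) + 14
  linear = solve-∀

φ-inSplit : ∀ a b o → a ≤ suc b → b ≤ suc a → 4 ≤ a + b →
  φ (suc a) 2 + (φ (suc b) 2 + (φ 2 o + 0)) ≡ φ (a + b) o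
φ-inSplit a b o a≤ b≤ 4≤ = begin
  φ (suc a) 2 + (φ (suc b) 2 + (φ 2 o + 0))      ≡⟨ regroup (P (suc a)) (P (suc b)) (P o) ⟩
  P (suc a) + P (suc b) + 11 + P o + 4           ≡⟨ cong (λ x → x + P o + 4) (P-balanced a b a≤ b≤ 4≤) ⟩
  P (a + b) + P o + 4                            ≡⟨ sym (φ-active-in (a + b) o (≤-trans (s≤s z≤n) 4≤)) ⟩
  φ (a + b) o                                    ∎
  where
  open ≡-Reasoning
  regroup : ∀ x y z → x + 1 + 4 + (y + 1 + 4 + (1 + z + 4 + 0)) ≡ x + y + 11 + z + 4
  regroup = solve-∀

φ-outSplit : ∀ a b i → a ≤ suc b → b ≤ suc a → 4 ≤ a + b →
  φ i 2 + (φ 2 (suc a) + (φ 2 (suc b) + 0)) ≡ φ i (a + b)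
φ-outSplit a b i a≤ b≤ 4≤ = begin
  φ i 2 + (φ 2 (suc a) + (φ 2 (suc b) + 0))      ≡⟨ cong (_+ _) (φ-active-out i 2 (s≤s z≤n)) ⟩
  P i + 1 + 4 + (φ 2 (suc a) + (φ 2 (suc b) + 0)) ≡⟨ regroup (P i) (P (suc a)) (P (suc b)) ⟩
  P i + (P (suc a) + P (suc b) + 11) + 4         ≡⟨ cong (λ x → P i + x + 4) (P-balanced a b a≤ b≤ 4≤) ⟩
  P i + P (a + b) + 4                            ≡⟨ sym (φ-active-out i (a + b) (≤-trans (s≤s z≤n) 4≤)) ⟩
  φ i (a + b)                                    ∎
  where
  open ≡-Reasoning
  regroup : ∀ x y z → x + 1 + 4 + (1 + y + 4 + (1 + z + 4 + 0)) ≡ x + (y + z + 11) + 4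
  regroup = solve-∀

P-linear : ∀ d → P d ≤ 25 * d + 1
P-linear 0 = by-evaluation
P-linear 1 = by-evaluation
P-linear 2 = by-evaluation
P-linear (suc (suc (suc n))) = ≤-trans (m≤m+n (25 * n + 14) 62) (≤-reflexive (linear n))
  where
  linear : ∀ n → 25 * n + 14 + 62 ≡ 25 * (3 + n) + 1
  linear = solve-∀

large-in : ∀ a o y → y ≤ 25 * o + 1 → 18 * 1 + (25 * suc a + 14 + y + 4) ≤ 25 * (4 + a + o)
large-in a o y y≤ = ≤-trans (+-monoʳ-≤ 18 (+-monoˡ-≤ 4 (+-monoʳ-≤ (25 * suc a + 14) y≤)))
  (≤-trans (m≤m+n _ 38) (≤-reflexive (linear a o)))
  where
  linear : ∀ a o → 18 * 1 + (25 * (1 + a) + 14 + (25 * o + 1) + 4) + 38 ≡ 25 * (4 + a + o)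
  linear = solve-∀

large-out : ∀ i b x → x ≤ 25 * i + 1 → 18 * 1 + (x + (25 * suc b + 14) + 4) ≤ 25 * (i + (4 + b))
large-out i b x x≤ = ≤-trans (+-monoʳ-≤ 18 (+-monoˡ-≤ 4 (+-monoˡ-≤ (25 * suc b + 14) x≤)))
  (≤-trans (m≤m+n _ 38) (≤-reflexive (linear i b)))
  where
  linear : ∀ i b → 18 * 1 + (25 * i + 1 + (25 * (1 + b) + 14) + 4) + 38 ≡ 25 * (i + (4 + b))
  linear = solve-∀

budget : ∀ i o → 18 * 𝟙 ((3 <ᵇ i) ∨ (3 <ᵇ o)) + φ i o ≤ 25 * (i + o)
budget (suc (suc (suc (suc a)))) o = large-in a o (P o) (P-linear o)
budget 0 (suc (suc (suc (suc b)))) = large-out 0 b (P 0) (P-linear 0)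
budget 1 (suc (suc (suc (suc b)))) = large-out 1 b (P 1) (P-linear 1)
budget 2 (suc (suc (suc (suc b)))) = large-out 2 b (P 2) (P-linear 2)
budget 3 (suc (suc (suc (suc b)))) = large-out 3 b (P 3) (P-linear 3)
budget 0 0 = by-evaluation
budget 0 1 = by-evaluation
budget 0 2 = by-evaluation
budget 0 3 = by-evaluation
budget 1 0 = by-evaluation
budget 1 1 = by-evaluation
budget 1 2 = by-evaluation
budget 1 3 = by-evaluation
budget 2 0 = by-evaluation
budget 2 1 = by-evaluation
budget 2 2 = by-evaluation
budget 2 3 = by-evaluation
budget 3 0 = by-evaluation
budget 3 1 = by-evaluation
budget 3 2 = by-evaluation
budget 3 3 = by-evaluation

if-≡ᵇ-then : ∀ b {p q} → q ≢ p → ((if b then p else q) ≡ᵇ p) ≡ b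
if-≡ᵇ-then true {p} _ = ≡ᵇ-refl p
if-≡ᵇ-then false q≢p = ≢⇒≡ᵇ-false q≢p

if-≡ᵇ-else : ∀ b {p q} → p ≢ q → ((if b then p else q) ≡ᵇ q) ≡ not b
if-≡ᵇ-else true p≢q = ≢⇒≡ᵇ-false p≢q
if-≡ᵇ-else false {q = q} _ = ≡ᵇ-refl q

if-≡ᵇ-neither : ∀ b {p q z} → p ≢ z → q ≢ z → ((if b then p else q) ≡ᵇ z) ≡ false
if-≡ᵇ-neither true p≢z _ = ≢⇒≡ᵇ-false p≢z
if-≡ᵇ-neither false _ q≢z = ≢⇒≡ᵇ-false q≢z

if-∈ : ∀ b {p q : ℕ} {xs} → p ∈ xs → q ∈ xs → (if b then p else q) ∈ xs
if-∈ true p∈ _ = p∈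
if-∈ false _ q∈ = q∈

module Division (f : ℕ → Bool) (N : List ℕ) (d : ℕ) (N≡d : length N ≡ d) (3<d : 3 < d)
                (balanced : BalancedChoice f N) where
  a b : ℕ
  a = count f N
  b = count (λ x → not (f x)) N

  a+b≡d : a + b ≡ d
  a+b≡d = trans (count-partition f N) N≡d

  4≤a+b : 4 ≤ a + b
  4≤a+b = subst (4 ≤_) (sym a+b≡d) 3<d

  a≤1+b : a ≤ suc b
  a≤1+b = proj₁ balanced

  b≤1+a : b ≤ suc a
  b≤1+a = proj₂ balanced

split-weight : ∀ {G} w p q → WellFormed G → Fresh2 (V G) p q →
  WellFormed (split G w p q) × Φ (split G w p q) ≤ 18 + Φ G
split-weight {G} w p q wf (p∉ , q∉ , p≢q) =
  wellFormed ((p≢q ∷ []) ∷ [] ∷ []) , weight-bound φ refl 18 new-cost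
  where
  open Rewiring G wf w (p ∷ q ∷ []) (λ _ → q) (λ _ → p) ((p , q) ∷ [])
                (p∉ ∷ q∉ ∷ []) (λ _ → there (here refl)) (λ _ → here refl) ((here refl , there (here refl)) ∷ [])
  in-p : indeg G′ p ≡ indeg G w
  in-p rewrite indeg-new p (here refl) (λ _ → true) (λ _ → ≡ᵇ-refl p) | ≢⇒≡ᵇ-false (≢-sym p≢q)
    = trans (+-identityʳ _) (trans (count-true (inNbrs G w)) (length-inNbrs G w))
  out-p : outdeg G′ p ≡ 1
  out-p rewrite outdeg-new p (here refl) (λ _ → false) (λ _ → ≢⇒≡ᵇ-false (≢-sym p≢q)) | ≡ᵇ-refl p
    = cong (_+ 1) (count-false (outNbrs G w))
  in-q : indeg G′ q ≡ 1
  in-q rewrite indeg-new q (there (here refl)) (λ _ → false) (λ _ → ≢⇒≡ᵇ-false p≢q) | ≡ᵇ-refl q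
    = cong (_+ 1) (count-false (inNbrs G w))
  out-q : outdeg G′ q ≡ outdeg G w
  out-q rewrite outdeg-new q (there (here refl)) (λ _ → true) (λ _ → ≡ᵇ-refl q) | ≢⇒≡ᵇ-false p≢q
    = trans (+-identityʳ _) (trans (count-true (outNbrs G w)) (length-outNbrs G w))
  new-cost : weight φ G′ (p ∷ q ∷ []) ≤ φ (indeg G w) (outdeg G w) + 18
  new-cost rewrite in-p | out-p | in-q | out-q = φ-split (indeg G w) (outdeg G w)

inSplit-weight : ∀ {G} w p q t f → WellFormed G → 3 < indeg G w → Fresh3 (V G) p q t →
  BalancedChoice f (inNbrs G w) → WellFormed (inSplit G w p q t f) × Φ (inSplit G w p q t f) ≤ Φ G
inSplit-weight {G} w p q t f wf 3<i (p∉ , q∉ , t∉ , p≢q , p≢t , q≢t) balanced =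
  wellFormed ((p≢q ∷ p≢t ∷ []) ∷ (q≢t ∷ []) ∷ [] ∷ []) , weight-bound φ refl 0 new-cost
  where
  p∈ : p ∈ p ∷ q ∷ t ∷ []
  p∈ = here refl
  q∈ : q ∈ p ∷ q ∷ t ∷ []
  q∈ = there (here refl)
  t∈ : t ∈ p ∷ q ∷ t ∷ []
  t∈ = there (there (here refl))
  open Rewiring G wf w (p ∷ q ∷ t ∷ []) (λ _ → t) (λ a → if f (proj₁ a) then p else q)
                ((p , q) ∷ (q , p) ∷ (p , t) ∷ (q , t) ∷ [])
                (p∉ ∷ q∉ ∷ t∉ ∷ []) (λ _ → t∈) (λ a → if-∈ (f (proj₁ a)) p∈ q∈)
                ((p∈ , q∈) ∷ (q∈ , p∈) ∷ (p∈ , t∈) ∷ (q∈ , t∈) ∷ [])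
  open Division f (inNbrs G w) (indeg G w) (length-inNbrs G w) 3<i balanced
  in-p : indeg G′ p ≡ suc a
  in-p rewrite indeg-new p p∈ f (λ x → if-≡ᵇ-then (f (proj₁ x)) (≢-sym p≢q))
             | ≢⇒≡ᵇ-false (≢-sym p≢q) | ≡ᵇ-refl p | ≢⇒≡ᵇ-false (≢-sym p≢t) = +-comm a 1
  in-q : indeg G′ q ≡ suc b
  in-q rewrite indeg-new q q∈ (λ x → not (f x)) (λ x → if-≡ᵇ-else (f (proj₁ x)) p≢q)
             | ≡ᵇ-refl q | ≢⇒≡ᵇ-false p≢q | ≢⇒≡ᵇ-false (≢-sym q≢t) = +-comm b 1
  in-t : indeg G′ t ≡ 2
  in-t rewrite indeg-new t t∈ (λ _ → false) (λ x → if-≡ᵇ-neither (f (proj₁ x)) p≢t q≢t)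
             | ≢⇒≡ᵇ-false q≢t | ≢⇒≡ᵇ-false p≢t | ≡ᵇ-refl t = cong (_+ 2) (count-false (inNbrs G w))
  out-p : outdeg G′ p ≡ 2
  out-p rewrite outdeg-new p p∈ (λ _ → false) (λ _ → ≢⇒≡ᵇ-false (≢-sym p≢t))
              | ≡ᵇ-refl p | ≢⇒≡ᵇ-false (≢-sym p≢q) = cong (_+ 2) (count-false (outNbrs G w))
  out-q : outdeg G′ q ≡ 2
  out-q rewrite outdeg-new q q∈ (λ _ → false) (λ _ → ≢⇒≡ᵇ-false (≢-sym q≢t))
              | ≢⇒≡ᵇ-false p≢q | ≡ᵇ-refl q = cong (_+ 2) (count-false (outNbrs G w))
  out-t : outdeg G′ t ≡ outdeg G w
  out-t rewrite outdeg-new t t∈ (λ _ → true) (λ _ → ≡ᵇ-refl t)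
              | ≢⇒≡ᵇ-false p≢t | ≢⇒≡ᵇ-false q≢t
    = trans (+-identityʳ _) (trans (count-true (outNbrs G w)) (length-outNbrs G w))
  new-cost : weight φ G′ (p ∷ q ∷ t ∷ []) ≤ φ (indeg G w) (outdeg G w) + 0
  new-cost rewrite in-p | in-q | in-t | out-p | out-q | out-t | +-identityʳ (φ (indeg G w) (outdeg G w)) =
    ≤-reflexive (trans (φ-inSplit a b (outdeg G w) a≤1+b b≤1+a 4≤a+b) (cong (λ i → φ i (outdeg G w)) a+b≡d))

outSplit-weight : ∀ {G} w p q t g → WellFormed G → 3 < outdeg G w → Fresh3 (V G) p q t →
  BalancedChoice g (outNbrs G w) → WellFormed (outSplit G w p q t g) × Φ (outSplit G w p q t g) ≤ Φ G
outSplit-weight {G} w p q t g wf 3<o (p∉ , q∉ , t∉ , p≢q , p≢t , q≢t) balanced =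
  wellFormed ((p≢q ∷ p≢t ∷ []) ∷ (q≢t ∷ []) ∷ [] ∷ []) , weight-bound φ refl 0 new-cost
  where
  p∈ : p ∈ p ∷ q ∷ t ∷ []
  p∈ = here refl
  q∈ : q ∈ p ∷ q ∷ t ∷ []
  q∈ = there (here refl)
  t∈ : t ∈ p ∷ q ∷ t ∷ []
  t∈ = there (there (here refl))
  open Rewiring G wf w (p ∷ q ∷ t ∷ []) (λ a → if g (proj₂ a) then q else t) (λ _ → p)
                ((p , q) ∷ (p , t) ∷ (q , t) ∷ (t , q) ∷ [])
                (p∉ ∷ q∉ ∷ t∉ ∷ []) (λ a → if-∈ (g (proj₂ a)) q∈ t∈) (λ _ → p∈)
                ((p∈ , q∈) ∷ (p∈ , t∈) ∷ (q∈ , t∈) ∷ (t∈ , q∈) ∷ [])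
  open Division g (outNbrs G w) (outdeg G w) (length-outNbrs G w) 3<o balanced
  in-p : indeg G′ p ≡ indeg G w
  in-p rewrite indeg-new p p∈ (λ _ → true) (λ _ → ≡ᵇ-refl p)
             | ≢⇒≡ᵇ-false (≢-sym p≢q) | ≢⇒≡ᵇ-false (≢-sym p≢t)
    = trans (+-identityʳ _) (trans (count-true (inNbrs G w)) (length-inNbrs G w))
  in-q : indeg G′ q ≡ 2
  in-q rewrite indeg-new q q∈ (λ _ → false) (λ _ → ≢⇒≡ᵇ-false p≢q)
             | ≡ᵇ-refl q | ≢⇒≡ᵇ-false (≢-sym q≢t) = cong (_+ 2) (count-false (inNbrs G w))
  in-t : indeg G′ t ≡ 2
  in-t rewrite indeg-new t t∈ (λ _ → false) (λ _ → ≢⇒≡ᵇ-false p≢t)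
             | ≢⇒≡ᵇ-false q≢t | ≡ᵇ-refl t = cong (_+ 2) (count-false (inNbrs G w))
  out-p : outdeg G′ p ≡ 2
  out-p rewrite outdeg-new p p∈ (λ _ → false) (λ x → if-≡ᵇ-neither (g (proj₂ x)) (≢-sym p≢q) (≢-sym p≢t))
              | ≡ᵇ-refl p | ≢⇒≡ᵇ-false (≢-sym p≢q) | ≢⇒≡ᵇ-false (≢-sym p≢t) = cong (_+ 2) (count-false (outNbrs G w))
  out-q : outdeg G′ q ≡ suc a
  out-q rewrite outdeg-new q q∈ g (λ x → if-≡ᵇ-then (g (proj₂ x)) (≢-sym q≢t))
              | ≢⇒≡ᵇ-false p≢q | ≡ᵇ-refl q | ≢⇒≡ᵇ-false (≢-sym q≢t) = +-comm a 1
  out-t : outdeg G′ t ≡ suc b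
  out-t rewrite outdeg-new t t∈ (λ x → not (g x)) (λ x → if-≡ᵇ-else (g (proj₂ x)) q≢t)
              | ≢⇒≡ᵇ-false p≢t | ≢⇒≡ᵇ-false q≢t | ≡ᵇ-refl t = +-comm b 1
  new-cost : weight φ G′ (p ∷ q ∷ t ∷ []) ≤ φ (indeg G w) (outdeg G w) + 0
  new-cost rewrite in-p | in-q | in-t | out-p | out-q | out-t | +-identityʳ (φ (indeg G w) (outdeg G w)) =
    ≤-reflexive (trans (φ-outSplit a b (indeg G w) a≤1+b b≤1+a 4≤a+b) (cong (φ (indeg G w)) a+b≡d))

inPhase-weight : ∀ {G R G′ R′} → InPhase 3 G R G′ R′ → WellFormed G → WellFormed G′ × Φ G′ ≤ Φ G
inPhase-weight (stop _) wf = wf , ≤-refl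
inPhase-weight (step w p q t f _ 3<i fresh balanced rest) wf =
  let (wf₁ , Φ₁≤) = inSplit-weight w p q t f wf 3<i fresh balanced
      (wf₂ , Φ₂≤) = inPhase-weight rest wf₁
  in wf₂ , ≤-trans Φ₂≤ Φ₁≤

outPhase-weight : ∀ {G R G′ R′} → OutPhase 3 G R G′ R′ → WellFormed G → WellFormed G′ × Φ G′ ≤ Φ G
outPhase-weight (stop _) wf = wf , ≤-refl
outPhase-weight (step w p q t g _ 3<o fresh balanced rest) wf =
  let (wf₁ , Φ₁≤) = outSplit-weight w p q t g wf 3<o fresh balanced
      (wf₂ , Φ₂≤) = outPhase-weight rest wf₁
  in wf₂ , ≤-trans Φ₂≤ Φ₁≤

splittingProcedure-weight : ∀ {v G G′} → SplittingProcedure 3 v G G′ → WellFormed G →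
  WellFormed G′ × Φ G′ ≤ 18 + Φ G
splittingProcedure-weight {v} (p , q , _ , _ , _ , fresh , inPhase , outPhase) wf =
  let (wf₁ , Φ₁≤) = split-weight v p q wf fresh
      (wf₂ , Φ₂≤) = inPhase-weight inPhase wf₁
      (wf₃ , Φ₃≤) = outPhase-weight outPhase wf₂
  in wf₃ , ≤-trans Φ₃≤ (≤-trans Φ₂≤ Φ₁≤)

splitAll-weight : ∀ {G order G′} → SplitAll G order G′ → WellFormed G →
  WellFormed G′ × Φ G′ ≤ 18 * length order + Φ G
splitAll-weight done wf = wf , ≤-refl
splitAll-weight {G} (next {G₁ = G₁} {vs = vs} procedure rest) wf =
  let (wf₁ , Φ₁≤) = splittingProcedure-weight procedure wf
      (wf₂ , Φ₂≤) = splitAll-weight rest wf₁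
  in wf₂ , ≤-trans Φ₂≤ (≤-trans (+-monoʳ-≤ (18 * length vs) Φ₁≤) (≤-reflexive (regroup (length vs) (Φ G))))
  where
  regroup : ∀ l x → 18 * l + (18 + x) ≡ 18 * (1 + l) + x
  regroup = solve-∀

isDigraph⇒wellFormed : ∀ {Γ} → IsDigraph Γ → WellFormed Γ
isDigraph⇒wellFormed (uniq , _ , ends) = uniq , All-map proj₂ ends

step1-weight : ∀ {Γ G₁} → IsDigraph Γ → Step1 Γ G₁ → WellFormed G₁ × Φ G₁ ≤ 25 * degSum Γ
step1-weight {Γ} {G₁} isDigraph (order , order↭big , splitAll)
  with splitAll-weight splitAll (isDigraph⇒wellFormed isDigraph)
... | wf₁ , Φ₁≤ = wf₁ , (begin
    Φ G₁                                       ≤⟨ Φ₁≤ ⟩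
    18 * length order + Φ Γ                    ≡⟨ cong (λ l → 18 * l + Φ Γ) splittings ⟩
    18 * sumBy (λ v → 𝟙 (big v)) (V Γ) + Φ Γ    ≡⟨ cong (_+ Φ Γ) (sym (sumBy-* 18 _ (V Γ))) ⟩
    sumBy (λ v → 18 * 𝟙 (big v)) (V Γ) + Φ Γ    ≡⟨ sym (sumBy-+ _ _ (V Γ)) ⟩
    sumBy (λ v → 18 * 𝟙 (big v) + φ (indeg Γ v) (outdeg Γ v)) (V Γ)
                                               ≤⟨ sumBy-mono (V Γ) (λ v _ → budget (indeg Γ v) (outdeg Γ v)) ⟩
    sumBy (λ v → 25 * (indeg Γ v + outdeg Γ v)) (V Γ) ≡⟨ sumBy-* 25 _ (V Γ) ⟩
    25 * degSum Γ                              ∎)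
  where
  open ≤-Reasoning
  big : ℕ → Bool
  big v = (3 <ᵇ indeg Γ v) ∨ (3 <ᵇ outdeg Γ v)
  splittings : length order ≡ sumBy (λ v → 𝟙 (big v)) (V Γ)
  splittings = trans (↭-length order↭big) (count-as-sum big (V Γ))

-- Step (2): the undirected graph of a digraph.  The labels 3v, 3v+1, 3v+2
-- of a_v, b_v, c_v are determined by v and the slot 0, 1, 2.

slot-of : ∀ u r → r < 3 → (3 * u + r) % 3 ≡ r
slot-of u r r<3 = begin
  (3 * u + r) % 3 ≡⟨ cong (_% 3) (+-comm (3 * u) r) ⟩
  (r + 3 * u) % 3 ≡⟨ cong (λ x → (r + x) % 3) (*-comm 3 u) ⟩
  (r + u * 3) % 3 ≡⟨ [m+kn]%n≡m%n r u 3 ⟩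
  r % 3           ≡⟨ m<n⇒m%n≡m r<3 ⟩
  r               ∎
  where open ≡-Reasoning

label-injective : ∀ {u v r s} → r < 3 → s < 3 → 3 * u + r ≡ 3 * v + s → u ≡ v × r ≡ s
label-injective {u} {v} {r} {s} r<3 s<3 eq = *-cancelˡ-≡ u v 3 (+-cancelʳ-≡ s (3 * u) (3 * v) eq′) , r≡s
  where
  r≡s : r ≡ s
  r≡s = trans (sym (slot-of u r r<3)) (trans (cong (_% 3) eq) (slot-of v s s<3))
  eq′ : 3 * u + s ≡ 3 * v + s
  eq′ = subst (λ x → 3 * u + x ≡ 3 * v + s) r≡s eq

label-≡ᵇ : ∀ u v r s → r < 3 → s < 3 → (3 * u + r ≡ᵇ 3 * v + s) ≡ ((u ≡ᵇ v) ∧ (r ≡ᵇ s))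
label-≡ᵇ u v r s r<3 s<3 with ≡ᵇ-view u v | ≡ᵇ-view r s
... | inj₁ (refl , u≡ᵇv) | inj₁ (refl , r≡ᵇs) rewrite u≡ᵇv | r≡ᵇs = ≡ᵇ-refl (3 * u + r)
... | inj₁ (_ , u≡ᵇv) | inj₂ (r≢s , r≢ᵇs) rewrite u≡ᵇv | r≢ᵇs =
  ≢⇒≡ᵇ-false {3 * u + r} {3 * v + s} (λ eq → r≢s (proj₂ (label-injective {u} {v} r<3 s<3 eq)))
... | inj₂ (u≢v , u≢ᵇv) | _ rewrite u≢ᵇv = ≢⇒≡ᵇ-false {3 * u + r} {3 * v + s} (λ eq → u≢v (proj₁ (label-injective {u} {v} r<3 s<3 eq)))

private
  slot₀ : ∀ v → aV v ≡ 3 * v + 0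
  slot₀ v = sym (+-identityʳ (3 * v))

aa : ∀ u v → (aV u ≡ᵇ aV v) ≡ (u ≡ᵇ v)
aa u v = trans (cong₂ _≡ᵇ_ (slot₀ u) (slot₀ v)) (trans (label-≡ᵇ u v 0 0 by-evaluation by-evaluation) (∧-identityʳ _))
ba : ∀ u v → (bV u ≡ᵇ aV v) ≡ false
ba u v = trans (cong (bV u ≡ᵇ_) (slot₀ v)) (trans (label-≡ᵇ u v 1 0 by-evaluation by-evaluation) (∧-zeroʳ _))
ca : ∀ u v → (cV u ≡ᵇ aV v) ≡ false
ca u v = trans (cong (cV u ≡ᵇ_) (slot₀ v)) (trans (label-≡ᵇ u v 2 0 by-evaluation by-evaluation) (∧-zeroʳ _))
ab : ∀ u v → (aV u ≡ᵇ bV v) ≡ false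
ab u v = trans (cong (_≡ᵇ bV v) (slot₀ u)) (trans (label-≡ᵇ u v 0 1 by-evaluation by-evaluation) (∧-zeroʳ _))
bb : ∀ u v → (bV u ≡ᵇ bV v) ≡ (u ≡ᵇ v)
bb u v = trans (label-≡ᵇ u v 1 1 by-evaluation by-evaluation) (∧-identityʳ _)
cb : ∀ u v → (cV u ≡ᵇ bV v) ≡ false
cb u v = trans (label-≡ᵇ u v 2 1 by-evaluation by-evaluation) (∧-zeroʳ _)
ac : ∀ u v → (aV u ≡ᵇ cV v) ≡ false
ac u v = trans (cong (_≡ᵇ cV v) (slot₀ u)) (trans (label-≡ᵇ u v 0 2 by-evaluation by-evaluation) (∧-zeroʳ _))
bc : ∀ u v → (bV u ≡ᵇ cV v) ≡ false
bc u v = trans (label-≡ᵇ u v 1 2 by-evaluation by-evaluation) (∧-zeroʳ _)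
cc : ∀ u v → (cV u ≡ᵇ cV v) ≡ (u ≡ᵇ v)
cc u v = trans (label-≡ᵇ u v 2 2 by-evaluation by-evaluation) (∧-identityʳ _)

Simple : UGraph → Set
Simple H = Unique (UV H) × All (λ e → proj₁ e ≢ proj₂ e × proj₁ e ∈ UV H × proj₂ e ∈ UV H) (UE H)

triple : ℕ → List ℕ
triple v = aV v ∷ bV v ∷ cV v ∷ []

path : ℕ → List (ℕ × ℕ)
path v = (aV v , bV v) ∷ (bV v , cV v) ∷ []

arcEdge : ℕ × ℕ → ℕ × ℕ
arcEdge a = cV (proj₁ a) , aV (proj₂ a)

triple-slot : ∀ {x v} → x ∈ triple v → Σ[ r ∈ ℕ ] (r < 3 × x ≡ 3 * v + r)
triple-slot {v = v} (here refl) = 0 , by-evaluation , sym (+-identityʳ (3 * v))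
triple-slot (there (here refl)) = 1 , by-evaluation , refl
triple-slot (there (there (here refl))) = 2 , by-evaluation , refl

triples-disjoint : ∀ {x u v} → x ∈ triple u → x ∈ triple v → u ≡ v
triples-disjoint {u = u} {v} x∈u x∈v with triple-slot {v = u} x∈u | triple-slot {v = v} x∈v
... | r , r<3 , x≡ | s , s<3 , x≡′ = proj₁ (label-injective {u} {v} r<3 s<3 (trans (sym x≡) x≡′))

unique-triples : ∀ vs → Unique vs → Unique (concatMap triple vs)
unique-triples [] _ = []
unique-triples (v ∷ vs) (v∉vs ∷ uniq) = Unique.++⁺ distinct (unique-triples vs uniq) disjoint
  where
  distinct : Unique (triple v)
  distinct = (≡ᵇ-false⇒≢ (ab v v) ∷ ≡ᵇ-false⇒≢ (ac v v) ∷ []) ∷ (≡ᵇ-false⇒≢ (bc v v) ∷ []) ∷ [] ∷ []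
  disjoint : ∀ {x} → ¬ (x ∈ triple v × x ∈ concatMap triple vs)
  disjoint (x∈v , x∈vs) with ∈-concatMap⁻ vs x∈vs
  ... | u , u∈ , x∈u = All-lookup v∉vs u∈ (triples-disjoint x∈v x∈u)

module Undirected (G : Digraph) (wf : WellFormed G) where

  H₂ : UGraph
  H₂ = toUndirected G

  udeg-as-sum : ∀ x → udeg H₂ x ≡
    sumBy (λ u → sumBy (λ e → 𝟙 (incident x e)) (path u)) (V G) + sumBy (λ a → 𝟙 (incident x (arcEdge a))) (A G)
  udeg-as-sum x = begin
    udeg H₂ x ≡⟨ count-as-sum (incident x) (UE H₂) ⟩
    sumBy (λ e → 𝟙 (incident x e)) (UE H₂) ≡⟨ sumBy-++ _ (concatMap path (V G)) (map arcEdge (A G)) ⟩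
    _ ≡⟨ cong₂ _+_ (sumBy-concatMap _ path (V G)) (sumBy-map _ arcEdge (A G)) ⟩
    _ ∎
    where open ≡-Reasoning

  private
    on-path : ℕ → ℕ → ℕ
    on-path x u = sumBy (λ e → 𝟙 (incident x e)) (path u)

    each-once : ∀ {v} → v ∈ V G → sumBy (λ u → 𝟙 (u ≡ᵇ v)) (V G) ≡ 1
    each-once v∈ = count-unique (proj₁ wf) v∈

  udeg-a : ∀ v → v ∈ V G → udeg H₂ (aV v) ≡ suc (indeg G v)
  udeg-a v v∈ = begin
    udeg H₂ (aV v)                                          ≡⟨ udeg-as-sum (aV v) ⟩
    sumBy (on-path (aV v)) (V G) + _                        ≡⟨ cong₂ _+_ (sumBy-cong (V G) (λ u _ → on-path-a u)) (sumBy-cong (A G) (λ a _ → arc-a a)) ⟩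
    sumBy (λ u → 𝟙 (u ≡ᵇ v) + 0) (V G) + sumBy (λ a → 𝟙 (proj₂ a ≡ᵇ v)) (A G)
      ≡⟨ cong₂ _+_ (trans (sumBy-cong (V G) (λ u _ → +-identityʳ _)) (each-once v∈)) (sym (indeg-as-sum G v)) ⟩
    suc (indeg G v)                                         ∎
    where
    open ≡-Reasoning
    on-path-a : ∀ u → on-path (aV v) u ≡ 𝟙 (u ≡ᵇ v) + 0
    on-path-a u rewrite aa u v | ba u v | ca u v | ∨-identityʳ (u ≡ᵇ v) = refl
    arc-a : ∀ a → 𝟙 (incident (aV v) (arcEdge a)) ≡ 𝟙 (proj₂ a ≡ᵇ v)
    arc-a a rewrite ca (proj₁ a) v | aa (proj₂ a) v = refl

  udeg-b : ∀ v → v ∈ V G → udeg H₂ (bV v) ≡ 2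
  udeg-b v v∈ = begin
    udeg H₂ (bV v)                                          ≡⟨ udeg-as-sum (bV v) ⟩
    sumBy (on-path (bV v)) (V G) + _                        ≡⟨ cong₂ _+_ (sumBy-cong (V G) (λ u _ → on-path-b u)) (sumBy-zero (A G) (λ a _ → arc-b a)) ⟩
    sumBy (λ u → 𝟙 (u ≡ᵇ v) + 𝟙 (u ≡ᵇ v)) (V G) + 0        ≡⟨ cong (_+ 0) (trans (sumBy-+ _ _ (V G)) (cong₂ _+_ (each-once v∈) (each-once v∈))) ⟩
    2                                                       ∎
    where
    open ≡-Reasoning
    on-path-b : ∀ u → on-path (bV v) u ≡ 𝟙 (u ≡ᵇ v) + 𝟙 (u ≡ᵇ v)
    on-path-b u rewrite ab u v | bb u v | cb u v | ∨-identityʳ (u ≡ᵇ v) = cong (𝟙 (u ≡ᵇ v) +_) (+-identityʳ _)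
    arc-b : ∀ a → 𝟙 (incident (bV v) (arcEdge a)) ≡ 0
    arc-b a rewrite cb (proj₁ a) v | ab (proj₂ a) v = refl

  udeg-c : ∀ v → v ∈ V G → udeg H₂ (cV v) ≡ suc (outdeg G v)
  udeg-c v v∈ = begin
    udeg H₂ (cV v)                                          ≡⟨ udeg-as-sum (cV v) ⟩
    sumBy (on-path (cV v)) (V G) + _                        ≡⟨ cong₂ _+_ (sumBy-cong (V G) (λ u _ → on-path-c u)) (sumBy-cong (A G) (λ a _ → arc-c a)) ⟩
    sumBy (λ u → 𝟙 (u ≡ᵇ v) + 0) (V G) + sumBy (λ a → 𝟙 (proj₁ a ≡ᵇ v)) (A G)
      ≡⟨ cong₂ _+_ (trans (sumBy-cong (V G) (λ u _ → +-identityʳ _)) (each-once v∈)) (sym (outdeg-as-sum G v)) ⟩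
    suc (outdeg G v)                                        ∎
    where
    open ≡-Reasoning
    on-path-c : ∀ u → on-path (cV v) u ≡ 𝟙 (u ≡ᵇ v) + 0
    on-path-c u rewrite ac u v | bc u v | cc u v = refl
    arc-c : ∀ a → 𝟙 (incident (cV v) (arcEdge a)) ≡ 𝟙 (proj₁ a ≡ᵇ v)
    arc-c a rewrite cc (proj₁ a) v | ac (proj₂ a) v | ∨-identityʳ (proj₁ a ≡ᵇ v) = refl

  simple : Simple H₂
  simple = unique-triples (V G) (proj₁ wf) , tabulate edge-ok
    where
    in-triple : ∀ {u x} → u ∈ V G → x ∈ triple u → x ∈ UV H₂
    in-triple u∈ x∈ = ∈-concatMap⁺ (V G) u∈ x∈
    edge-ok : ∀ {e} → e ∈ UE H₂ → proj₁ e ≢ proj₂ e × proj₁ e ∈ UV H₂ × proj₂ e ∈ UV H₂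
    edge-ok e∈ with ∈-++⁻ (concatMap path (V G)) e∈
    ... | inj₁ e∈paths with ∈-concatMap⁻ (V G) e∈paths
    ...   | u , u∈ , here refl =
            ≡ᵇ-false⇒≢ (ab u u) , in-triple u∈ (here refl) , in-triple u∈ (there (here refl))
    ...   | u , u∈ , there (here refl) =
            ≡ᵇ-false⇒≢ (bc u u) , in-triple u∈ (there (here refl)) , in-triple u∈ (there (there (here refl)))
    edge-ok e∈ | inj₂ e∈arcs with ∈-map⁻ arcEdge e∈arcs
    ... | a , a∈ , refl =
          ≡ᵇ-false⇒≢ (ca (proj₁ a) (proj₂ a)) , in-triple (tail∈ {G} wf a∈) (there (there (here refl)))
                                             , in-triple (head∈ {G} wf a∈) (here refl)

  size : length (UV H₂) ≡ sumBy (λ _ → 3) (V G)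
  size = trans (length-as-sum (UV H₂)) (sumBy-concatMap (λ _ → 1) triple (V G))

  census : ∀ n → count (λ x → udeg H₂ x ≡ᵇ n) (UV H₂) ≡
    sumBy (λ v → 𝟙 (suc (indeg G v) ≡ᵇ n) + (𝟙 (2 ≡ᵇ n) + (𝟙 (suc (outdeg G v) ≡ᵇ n) + 0))) (V G)
  census n = trans (count-as-sum _ (UV H₂)) (trans (sumBy-concatMap _ triple (V G))
    (sumBy-cong (V G) (λ v v∈ → cong₂ (λ x y → 𝟙 (x ≡ᵇ n) + y) (udeg-a v v∈)
      (cong₂ (λ x y → 𝟙 (x ≡ᵇ n) + (𝟙 (y ≡ᵇ n) + 0)) (udeg-b v v∈) (udeg-c v v∈)))))

edgeNbrs : ℕ → ℕ × ℕ → List ℕ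
edgeNbrs x e = (if proj₁ e ≡ᵇ x then proj₂ e ∷ [] else []) ++ (if proj₂ e ≡ᵇ x then proj₁ e ∷ [] else [])

edgeNbrs-count : ∀ x y e → proj₁ e ≢ proj₂ e → y ≢ x →
  sumBy (λ z → 𝟙 (z ≡ᵇ y)) (edgeNbrs x e) ≡ 𝟙 (incident y e ∧ incident x e)
edgeNbrs-count x y (e₁ , e₂) e₁≢e₂ y≢x with ≡ᵇ-view e₁ x
... | inj₁ (refl , e₁≡ᵇx) rewrite e₁≡ᵇx | ≢⇒≡ᵇ-false (≢-sym e₁≢e₂) | ≢⇒≡ᵇ-false {e₁} {y} (≢-sym y≢x)
  | ∧-identityʳ (e₂ ≡ᵇ y) = +-identityʳ _
... | inj₂ (_ , e₁≢ᵇx) rewrite e₁≢ᵇx with ≡ᵇ-view e₂ x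
...   | inj₁ (refl , e₂≡ᵇx) rewrite e₂≡ᵇx | ≢⇒≡ᵇ-false {e₂} {y} (≢-sym y≢x)
        | ∨-identityʳ (e₁ ≡ᵇ y) | ∧-identityʳ (e₁ ≡ᵇ y) = +-identityʳ _
...   | inj₂ (_ , e₂≢ᵇx) rewrite e₂≢ᵇx | ∧-zeroʳ ((e₁ ≡ᵇ y) ∨ (e₂ ≡ᵇ y)) = refl

nbrs-count : ∀ H x y → All (λ e → proj₁ e ≢ proj₂ e) (UE H) → y ≢ x →
  sumBy (λ z → 𝟙 (z ≡ᵇ y)) (nbrs H x) ≡ sumBy (λ e → 𝟙 (incident y e ∧ incident x e)) (UE H)
nbrs-count H x y loopless y≢x = trans (sumBy-concatMap _ (edgeNbrs x) (UE H))
  (sumBy-cong (UE H) (λ e e∈ → edgeNbrs-count x y e (All-lookup loopless e∈) y≢x))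

edgeNbrs-mem : ∀ x y e → y ∈ edgeNbrs x e → (proj₁ e ≡ x × y ≡ proj₂ e) ⊎ (proj₂ e ≡ x × y ≡ proj₁ e)
edgeNbrs-mem x y (e₁ , e₂) y∈ with ≡ᵇ-view e₁ x | ≡ᵇ-view e₂ x
... | inj₁ (e₁≡x , t₁) | inj₁ (e₂≡x , t₂) rewrite t₁ | t₂ with y∈
...   | here y≡e₂ = inj₁ (e₁≡x , y≡e₂)
...   | there (here y≡e₁) = inj₂ (e₂≡x , y≡e₁)
edgeNbrs-mem x y (e₁ , e₂) y∈ | inj₁ (e₁≡x , t₁) | inj₂ (_ , f₂) rewrite t₁ | f₂ with y∈
...   | here y≡e₂ = inj₁ (e₁≡x , y≡e₂)
edgeNbrs-mem x y (e₁ , e₂) y∈ | inj₂ (_ , f₁) | inj₁ (e₂≡x , t₂) rewrite f₁ | t₂ with y∈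
...   | here y≡e₁ = inj₂ (e₂≡x , y≡e₁)
edgeNbrs-mem x y (e₁ , e₂) y∈ | inj₂ (_ , f₁) | inj₂ (_ , f₂) rewrite f₁ | f₂ with y∈
...   | ()

nbrs-mem : ∀ H {x y} → Simple H → y ∈ nbrs H x → y ∈ UV H × x ∈ UV H × y ≢ x
nbrs-mem H {x} {y} (_ , edges) y∈ with ∈-concatMap⁻ {g = edgeNbrs x} (UE H) y∈
... | e , e∈ , y∈e with All-lookup edges e∈ | edgeNbrs-mem x y e y∈e
...   | e₁≢e₂ , e₁∈ , e₂∈ | inj₁ (refl , refl) = e₂∈ , e₁∈ , ≢-sym e₁≢e₂
...   | e₁≢e₂ , e₁∈ , e₂∈ | inj₂ (refl , refl) = e₁∈ , e₂∈ , e₁≢e₂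

not-incident : ∀ x e → T (not (incident x e)) → proj₁ e ≢ x × proj₂ e ≢ x
not-incident x (e₁ , e₂) avoids =
  (λ { refl → subst (λ b → T (not (b ∨ (e₂ ≡ᵇ e₁)))) (≡ᵇ-refl e₁) avoids }) ,
  (λ { refl → subst (λ b → T (not b)) (trans (cong ((e₁ ≡ᵇ e₂) ∨_) (≡ᵇ-refl e₂)) (∨-zeroʳ _)) avoids })

incidence-split : ∀ b c → 𝟙 (not b ∧ c) + 𝟙 (c ∧ b) ≡ 𝟙 c
incidence-split true c rewrite ∧-identityʳ c = refl
incidence-split false c rewrite ∧-zeroʳ c = +-identityʳ _

#deg : ℕ → UGraph → ℕ
#deg n H = count (λ z → udeg H z ≡ᵇ n) (UV H)

sameFin : ∀ {n} → Fin n → Fin n → Bool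
sameFin i j = toℕ i ≡ᵇ toℕ j

gateDegree : Fin 11 → ℕ
gateDegree j = sumBy (λ e → 𝟙 (sameFin (proj₁ e) j ∨ sameFin (proj₂ e) j)) gateEdges
  + (𝟙 (sameFin (# 0) j) + (𝟙 (sameFin (# 1) j) + (𝟙 (sameFin (# 8) j) + (𝟙 (sameFin (# 10) j) + 0))))

-- the gate contributes a single vertex of degree 2 (its vertex 6)
gate-census : (gs : Vec ℕ 11) (d : ℕ → ℕ) → (∀ j → d (lookup gs j) ≡ gateDegree j) →
  count (λ z → d z ≡ᵇ 2) (toList gs) ≤ 1
gate-census (g₀ ∷ᵛ g₁ ∷ᵛ g₂ ∷ᵛ g₃ ∷ᵛ g₄ ∷ᵛ g₅ ∷ᵛ g₆ ∷ᵛ g₇ ∷ᵛ g₈ ∷ᵛ g₉ ∷ᵛ g₁₀ ∷ᵛ []ᵛ) d degree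
  rewrite count-as-sum (λ z → d z ≡ᵇ 2) (g₀ ∷ g₁ ∷ g₂ ∷ g₃ ∷ g₄ ∷ g₅ ∷ g₆ ∷ g₇ ∷ g₈ ∷ g₉ ∷ g₁₀ ∷ [])
        | degree (# 0) | degree (# 1) | degree (# 2) | degree (# 3) | degree (# 4) | degree (# 5)
        | degree (# 6) | degree (# 7) | degree (# 8) | degree (# 9) | degree (# 10) = by-evaluation

gate-loopless : All (λ e → proj₁ e ≢ proj₂ e) gateEdges
gate-loopless = (λ ()) ∷ (λ ()) ∷ (λ ()) ∷ (λ ()) ∷ (λ ()) ∷ (λ ()) ∷ (λ ()) ∷
                (λ ()) ∷ (λ ()) ∷ (λ ()) ∷ (λ ()) ∷ (λ ()) ∷ (λ ()) ∷ (λ ()) ∷ []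

lookup∈ : ∀ {n} (gs : Vec ℕ n) i → lookup gs i ∈ toList gs
lookup∈ gs i = ∈-toList⁺ (∈-lookup i gs)

lookup-injective : ∀ {n} (gs : Vec ℕ n) → Unique (toList gs) → ∀ i j → lookup gs i ≡ lookup gs j → i ≡ j
lookup-injective (g ∷ᵛ gs) _ Fin.zero Fin.zero _ = refl
lookup-injective (g ∷ᵛ gs) (g∉ ∷ _) Fin.zero (Fin.suc j) eq = ⊥-elim (All-lookup g∉ (lookup∈ gs j) eq)
lookup-injective (g ∷ᵛ gs) (g∉ ∷ _) (Fin.suc i) Fin.zero eq = ⊥-elim (All-lookup g∉ (lookup∈ gs i) (sym eq))
lookup-injective (g ∷ᵛ gs) (_ ∷ distinct) (Fin.suc i) (Fin.suc j) eq = cong Fin.suc (lookup-injective gs distinct i j eq)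

lookup-≡ᵇ : ∀ {n} (gs : Vec ℕ n) → Unique (toList gs) → ∀ i j → (lookup gs i ≡ᵇ lookup gs j) ≡ sameFin i j
lookup-≡ᵇ gs distinct i j with i ≟ᶠ j
... | yes refl = trans (≡ᵇ-refl (lookup gs i)) (sym (≡ᵇ-refl (toℕ i)))
... | no i≢j = trans (≢⇒≡ᵇ-false (λ eq → i≢j (lookup-injective gs distinct i j eq)))
                     (sym (≢⇒≡ᵇ-false (λ eq → i≢j (toℕ-injective eq))))

module GateReplacement (H : UGraph) (simple : Simple H) (x : ℕ) (gs : Vec ℕ 11) (n₁ n₂ n₃ n₄ : ℕ)
                       (distinct : Unique (toList gs)) (fresh : All (_∉ UV H) (toList gs))
                       (attached : (n₁ ∷ n₂ ∷ n₃ ∷ n₄ ∷ []) ↭ nbrs H x) where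

  H′ : UGraph
  H′ = gateReplace H x gs n₁ n₂ n₃ n₄

  g : Fin 11 → ℕ
  g = lookup gs

  kept inner attachments : List (ℕ × ℕ)
  kept = filterᵇ (λ e → not (incident x e)) (UE H)
  inner = map (λ e → g (proj₁ e) , g (proj₂ e)) gateEdges
  attachments = (n₁ , g (# 0)) ∷ (n₂ , g (# 1)) ∷ (n₃ , g (# 8)) ∷ (n₄ , g (# 10)) ∷ []

  g∉ : ∀ i → g i ∉ UV H
  g∉ i = All-lookup fresh (lookup∈ gs i)

  neighbour : ∀ {n} → n ∈ (n₁ ∷ n₂ ∷ n₃ ∷ n₄ ∷ []) → n ∈ UV H × x ∈ UV H × n ≢ x
  neighbour n∈ = nbrs-mem H simple (∈-resp-↭ attached n∈)

  x∈ : x ∈ UV H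
  x∈ = proj₁ (proj₂ (neighbour (here refl)))

  udeg-parts : ∀ y → udeg H′ y ≡
    sumBy (λ e → 𝟙 (incident y e)) kept + (sumBy (λ e → 𝟙 (incident y e)) inner + sumBy (λ e → 𝟙 (incident y e)) attachments)
  udeg-parts y = trans (count-as-sum (incident y) (UE H′))
    (trans (sumBy-++ (λ e → 𝟙 (incident y e)) kept (inner ++ attachments))
           (cong (sumBy (λ e → 𝟙 (incident y e)) kept +_) (sumBy-++ (λ e → 𝟙 (incident y e)) inner attachments)))

  -- a vertex other than x keeps its degree: its edges to x become its
  -- attachment edges
  udeg-old : ∀ y → y ∈ UV H → y ≢ x → udeg H′ y ≡ udeg H y
  udeg-old y y∈ y≢x = begin
    udeg H′ y ≡⟨ udeg-parts y ⟩
    _         ≡⟨ cong₂ _+_ (sumBy-filter _ (incident y) (UE H)) (cong₂ _+_ untouched via-nbrs) ⟩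
    sumBy (λ e → 𝟙 (not (incident x e) ∧ incident y e)) (UE H) + (0 + sumBy (λ e → 𝟙 (incident y e ∧ incident x e)) (UE H))
              ≡⟨ sym (sumBy-+ _ _ (UE H)) ⟩
    sumBy (λ e → 𝟙 (not (incident x e) ∧ incident y e) + 𝟙 (incident y e ∧ incident x e)) (UE H)
              ≡⟨ sumBy-cong (UE H) (λ e _ → incidence-split (incident x e) (incident y e)) ⟩
    sumBy (λ e → 𝟙 (incident y e)) (UE H) ≡⟨ sym (count-as-sum (incident y) (UE H)) ⟩
    udeg H y  ∎
    where
    open ≡-Reasoning
    g≢y : ∀ i → (g i ≡ᵇ y) ≡ false
    g≢y i = ≢⇒≡ᵇ-false {g i} {y} (λ { refl → g∉ i y∈ })
    untouched : sumBy (λ e → 𝟙 (incident y e)) inner ≡ 0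
    untouched = trans (sumBy-map (λ e → 𝟙 (incident y e)) (λ e → g (proj₁ e) , g (proj₂ e)) gateEdges)
      (sumBy-zero gateEdges (λ e _ → cong 𝟙 (cong₂ _∨_ (g≢y (proj₁ e)) (g≢y (proj₂ e)))))
    attachment-ends : sumBy (λ e → 𝟙 (incident y e)) attachments ≡ sumBy (λ z → 𝟙 (z ≡ᵇ y)) (n₁ ∷ n₂ ∷ n₃ ∷ n₄ ∷ [])
    attachment-ends rewrite g≢y (# 0) | g≢y (# 1) | g≢y (# 8) | g≢y (# 10)
      | ∨-identityʳ (n₁ ≡ᵇ y) | ∨-identityʳ (n₂ ≡ᵇ y) | ∨-identityʳ (n₃ ≡ᵇ y) | ∨-identityʳ (n₄ ≡ᵇ y) = refl
    via-nbrs : sumBy (λ e → 𝟙 (incident y e)) attachments ≡ sumBy (λ e → 𝟙 (incident y e ∧ incident x e)) (UE H)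
    via-nbrs = trans attachment-ends (trans (sumBy-↭ _ attached) (nbrs-count H x y (All-map proj₁ (proj₂ simple)) y≢x))

  udeg-gate : ∀ j → udeg H′ (g j) ≡ gateDegree j
  udeg-gate j = trans (udeg-parts (g j)) (cong₂ _+_ no-old-edge (cong₂ _+_ inner-edges attachment-edges))
    where
    old≢g : ∀ {z} → z ∈ UV H → (z ≡ᵇ g j) ≡ false
    old≢g {z} z∈ = ≢⇒≡ᵇ-false {z} {g j} (λ { refl → g∉ j z∈ })
    no-old-edge : sumBy (λ e → 𝟙 (incident (g j) e)) kept ≡ 0
    no-old-edge = sumBy-zero kept (λ e e∈ →
      let (_ , e₁∈ , e₂∈) = All-lookup (proj₂ simple) (proj₁ (∈-filterᵇ⁻ (λ e → not (incident x e)) {xs = UE H} e∈))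
      in cong 𝟙 (cong₂ _∨_ (old≢g e₁∈) (old≢g e₂∈)))
    inner-edges : sumBy (λ e → 𝟙 (incident (g j) e)) inner ≡
                  sumBy (λ e → 𝟙 (sameFin (proj₁ e) j ∨ sameFin (proj₂ e) j)) gateEdges
    inner-edges = trans (sumBy-map (λ e → 𝟙 (incident (g j) e)) (λ e → g (proj₁ e) , g (proj₂ e)) gateEdges) (sumBy-cong gateEdges (λ e _ →
      cong 𝟙 (cong₂ _∨_ (lookup-≡ᵇ gs distinct (proj₁ e) j) (lookup-≡ᵇ gs distinct (proj₂ e) j))))
    attachment-edges : sumBy (λ e → 𝟙 (incident (g j) e)) attachments ≡
      𝟙 (sameFin (# 0) j) + (𝟙 (sameFin (# 1) j) + (𝟙 (sameFin (# 8) j) + (𝟙 (sameFin (# 10) j) + 0)))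
    attachment-edges
      rewrite old≢g (proj₁ (neighbour (here refl))) | old≢g (proj₁ (neighbour (there (here refl))))
            | old≢g (proj₁ (neighbour (there (there (here refl)))))
            | old≢g (proj₁ (neighbour (there (there (there (here refl))))))
            | lookup-≡ᵇ gs distinct (# 0) j | lookup-≡ᵇ gs distinct (# 1) j
            | lookup-≡ᵇ gs distinct (# 8) j | lookup-≡ᵇ gs distinct (# 10) j = refl

  old∈ : ∀ {z} → z ∈ UV H → z ≢ x → z ∈ UV H′
  old∈ z∈ z≢x = ∈-++⁺ˡ (∈-removeL⁺ z∈ z≢x)

  gate∈ : ∀ i → g i ∈ UV H′
  gate∈ i = ∈-++⁺ʳ (removeL x (UV H)) (lookup∈ gs i)

  simple′ : Simple H′
  simple′ = Unique.++⁺ (Unique.filter⁺ _ (proj₁ simple)) distinct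
              (λ { (z∈old , z∈gate) → All-lookup fresh z∈gate (proj₁ (∈-removeL⁻ {xs = UV H} z∈old)) }) ,
            All-++⁺ kept-ok (All-++⁺ inner-ok attachments-ok)
    where
    Ok : ℕ × ℕ → Set
    Ok e = proj₁ e ≢ proj₂ e × proj₁ e ∈ UV H′ × proj₂ e ∈ UV H′
    kept-ok : All Ok kept
    kept-ok = tabulate (λ {e} e∈ →
      let (e∈H , avoids) = ∈-filterᵇ⁻ (λ e → not (incident x e)) {xs = UE H} e∈
          (e₁≢e₂ , e₁∈ , e₂∈) = All-lookup (proj₂ simple) e∈H
          (e₁≢x , e₂≢x) = not-incident x e avoids
      in e₁≢e₂ , old∈ e₁∈ e₁≢x , old∈ e₂∈ e₂≢x)
    inner-ok : All Ok inner
    inner-ok = All-map⁺ (tabulate (λ {e} e∈ →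
      (λ eq → All-lookup gate-loopless e∈ (lookup-injective gs distinct (proj₁ e) (proj₂ e) eq)) ,
      gate∈ (proj₁ e) , gate∈ (proj₂ e)))
    attachment-ok : ∀ {n} i → n ∈ (n₁ ∷ n₂ ∷ n₃ ∷ n₄ ∷ []) → Ok (n , g i)
    attachment-ok i n∈ = let (n∈H , _ , n≢x) = neighbour n∈ in
      (λ { refl → g∉ i n∈H }) , old∈ n∈H n≢x , gate∈ i
    attachments-ok : All Ok attachments
    attachments-ok = attachment-ok (# 0) (here refl) ∷ attachment-ok (# 1) (there (here refl)) ∷
                     attachment-ok (# 8) (there (there (here refl))) ∷
                     attachment-ok (# 10) (there (there (there (here refl)))) ∷ []

  size′ : length (UV H′) ≤ 10 + length (UV H)
  size′ = begin
    length (UV H′)                        ≡⟨ length-++ (removeL x (UV H)) ⟩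
    length (removeL x (UV H)) + length (toList gs) ≡⟨ cong (_ +_) (length-toList gs) ⟩
    length (removeL x (UV H)) + 11        ≡⟨ +-comm _ 11 ⟩
    10 + suc (length (removeL x (UV H)))  ≤⟨ +-monoʳ-≤ 10 (length-removeL x∈) ⟩
    10 + length (UV H)                    ∎
    where open ≤-Reasoning

  census′ : #deg 2 H′ ≤ 1 + #deg 2 H
  census′ = begin
    #deg 2 H′ ≡⟨ trans (count-as-sum _ (UV H′)) (sumBy-++ _ (removeL x (UV H)) (toList gs)) ⟩
    sumBy (λ z → 𝟙 (udeg H′ z ≡ᵇ 2)) (removeL x (UV H)) + sumBy (λ z → 𝟙 (udeg H′ z ≡ᵇ 2)) (toList gs)
      ≡⟨ cong₂ _+_ (sumBy-cong (removeL x (UV H)) (λ z z∈ → let (z∈H , z≢x) = ∈-removeL⁻ z∈ in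
                      cong (λ d → 𝟙 (d ≡ᵇ 2)) (udeg-old z z∈H z≢x)))
                   (sym (count-as-sum _ (toList gs))) ⟩
    sumBy (λ z → 𝟙 (udeg H z ≡ᵇ 2)) (removeL x (UV H)) + count (λ z → udeg H′ z ≡ᵇ 2) (toList gs)
      ≤⟨ +-mono-≤ (sumBy-filter-≤ _ _ (UV H)) (gate-census gs (udeg H′) udeg-gate) ⟩
    sumBy (λ z → 𝟙 (udeg H z ≡ᵇ 2)) (UV H) + 1
      ≡⟨ trans (+-comm _ 1) (cong (1 +_) (sym (count-as-sum _ (UV H)))) ⟩
    1 + #deg 2 H ∎
    where open ≤-Reasoning

record GateBounds (H H′ : UGraph) (order : List ℕ) : Set where
  field
    simple-after : Simple H′
    size-after : length (UV H′) ≤ 10 * length order + length (UV H)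
    deg2-after : #deg 2 H′ ≤ length order + #deg 2 H
    untouched : ∀ z → z ∈ UV H → z ∉ order → z ∈ UV H′ × udeg H′ z ≡ udeg H z

gateStep-bounds : ∀ {H x H′} → GateStep H x H′ → Simple H → GateBounds H H′ (x ∷ [])
gateStep-bounds (gs , n₁ , n₂ , n₃ , n₄ , distinct , fresh , attached , refl) simple = record
  { simple-after = simple′
  ; size-after = size′
  ; deg2-after = census′
  ; untouched = λ y y∈ y∉ → let y≢x = λ y≡x → y∉ (here y≡x) in old∈ y∈ y≢x , udeg-old y y∈ y≢x
  }
  where open GateReplacement _ simple _ gs n₁ n₂ n₃ n₄ distinct fresh attached

gateBounds-compose : ∀ {H H₁ H₂ o₁ o₂} → GateBounds H H₁ o₁ → GateBounds H₁ H₂ o₂ → GateBounds H H₂ (o₁ ++ o₂)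
gateBounds-compose {H} {H₁} {H₂} {o₁} {o₂} first second = record
  { simple-after = simple-after second
  ; size-after = begin
      length (UV H₂)                                    ≤⟨ size-after second ⟩
      10 * length o₂ + length (UV H₁)                   ≤⟨ +-monoʳ-≤ (10 * length o₂) (size-after first) ⟩
      10 * length o₂ + (10 * length o₁ + length (UV H)) ≡⟨ regroup (length o₁) (length o₂) _ ⟩
      10 * (length o₁ + length o₂) + length (UV H)      ≡⟨ cong (λ l → 10 * l + length (UV H)) (sym (length-++ o₁)) ⟩
      10 * length (o₁ ++ o₂) + length (UV H)            ∎
  ; deg2-after = begin
      #deg 2 H₂                              ≤⟨ deg2-after second ⟩
      length o₂ + #deg 2 H₁                  ≤⟨ +-monoʳ-≤ (length o₂) (deg2-after first) ⟩
      length o₂ + (length o₁ + #deg 2 H)     ≡⟨ swap-front (length o₂) (length o₁) _ ⟩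
      length o₁ + length o₂ + #deg 2 H       ≡⟨ cong (_+ #deg 2 H) (sym (length-++ o₁)) ⟩
      length (o₁ ++ o₂) + #deg 2 H           ∎
  ; untouched = λ z z∈ z∉ →
      let (z∈₁ , deg₁) = untouched first z z∈ (λ z∈o₁ → z∉ (∈-++⁺ˡ z∈o₁))
          (z∈₂ , deg₂) = untouched second z z∈₁ (λ z∈o₂ → z∉ (∈-++⁺ʳ o₁ z∈o₂))
      in z∈₂ , trans deg₂ deg₁
  }
  where
  open GateBounds
  open ≤-Reasoning
  regroup : ∀ l₁ l₂ n → 10 * l₂ + (10 * l₁ + n) ≡ 10 * (l₁ + l₂) + n
  regroup = solve-∀
  swap-front : ∀ a b n → a + (b + n) ≡ b + a + n
  swap-front = solve-∀

gateAll-bounds : ∀ {H order H′} → GateAll H order H′ → Simple H → GateBounds H H′ order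
gateAll-bounds done simple = record
  { simple-after = simple ; size-after = ≤-refl ; deg2-after = ≤-refl ; untouched = λ z z∈ _ → z∈ , refl }
gateAll-bounds (next replacement rest) simple =
  let first = gateStep-bounds replacement simple
  in gateBounds-compose first (gateAll-bounds rest (GateBounds.simple-after first))

unique-↭ : ∀ {xs ys : List ℕ} → xs ↭ ys → Unique xs → Unique ys
unique-↭ xs↭ys = PermutationSetoid.Unique-resp-↭ (↭⇒↭ₛ xs↭ys)
  where module PermutationSetoid = Data.List.Relation.Binary.Permutation.Setoid.Properties (setoid ℕ)

diamondAll-size : ∀ {H order H′} → DiamondAll H order H′ → Unique order → All (_∈ UV H) order →
  length (UV H′) ≤ 3 * length order + length (UV H)
diamondAll-size done _ _ = ≤-refl
diamondAll-size {H} {H′ = H′} (next {s = s} {ss = ss} (u , w , x , y , z , t , _ , _ , _ , refl) rest)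
                (s∉ss ∷ uniq) (s∈ ∷ ss∈) = begin
  length (UV H′)                             ≤⟨ diamondAll-size rest uniq (tabulate still-there) ⟩
  3 * length ss + length (UV H₁)             ≤⟨ +-monoʳ-≤ (3 * length ss) one-diamond ⟩
  3 * length ss + (3 + length (UV H))        ≡⟨ regroup (length ss) (length (UV H)) ⟩
  3 * length (s ∷ ss) + length (UV H)        ∎
  where
  open ≤-Reasoning
  H₁ : UGraph
  H₁ = diamond H s u w x y z t
  one-diamond : length (UV H₁) ≤ 3 + length (UV H)
  one-diamond = begin
    length (UV H₁)                        ≡⟨ length-++ (removeL s (UV H)) ⟩
    length (removeL s (UV H)) + 4         ≡⟨ +-comm _ 4 ⟩
    3 + suc (length (removeL s (UV H)))   ≤⟨ +-monoʳ-≤ 3 (length-removeL s∈) ⟩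
    3 + length (UV H)                     ∎
  still-there : ∀ {r} → r ∈ ss → r ∈ UV H₁
  still-there r∈ = ∈-++⁺ˡ (∈-removeL⁺ (All-lookup ss∈ r∈) (λ { refl → All-lookup s∉ss r∈ refl }))
  regroup : ∀ l n → 3 * l + (3 + n) ≡ 3 * (1 + l) + n
  regroup = solve-∀

-- the final vertices coming from an endpoint a_v or c_v of degree d + 1:
-- itself, plus 3 if it is replaced by a diamond, plus 13 if it is
-- replaced by a gate (whose vertex 6 then becomes a diamond)
endpointCost : ℕ → ℕ
endpointCost d = 1 + 3 * 𝟙 (suc d ≡ᵇ 2) + 13 * 𝟙 (suc d ≡ᵇ 4)

endpointCost≤P : ∀ d → endpointCost d ≤ P d
endpointCost≤P 0 = by-evaluation
endpointCost≤P 1 = by-evaluation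
endpointCost≤P 2 = by-evaluation
endpointCost≤P 3 = by-evaluation
endpointCost≤P (suc (suc (suc (suc n)))) = s≤s z≤n

slotsOfDeg : ℕ → ℕ → ℕ → ℕ
slotsOfDeg n i o = 𝟙 (suc i ≡ᵇ n) + (𝟙 (2 ≡ᵇ n) + (𝟙 (suc o ≡ᵇ n) + 0))

vertexCost : ℕ → ℕ → ℕ
vertexCost i o = 3 * (slotsOfDeg 4 i o + slotsOfDeg 2 i o) + (10 * slotsOfDeg 4 i o + 3)

vertexCost≤φ : ∀ i o → 0 < i → vertexCost i o ≤ φ i o
vertexCost≤φ i o 0<i = begin
  vertexCost i o                       ≡⟨ regroup (𝟙 (suc i ≡ᵇ 4)) (𝟙 (suc o ≡ᵇ 4)) (𝟙 (suc i ≡ᵇ 2)) (𝟙 (suc o ≡ᵇ 2)) ⟩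
  endpointCost i + endpointCost o + 4  ≤⟨ +-monoˡ-≤ 4 (+-mono-≤ (endpointCost≤P i) (endpointCost≤P o)) ⟩
  P i + P o + 4                        ≡⟨ sym (φ-active-in i o 0<i) ⟩
  φ i o                                ∎
  where
  open ≤-Reasoning
  regroup : ∀ a b c d → 3 * ((a + (0 + (b + 0))) + (c + (1 + (d + 0)))) + (10 * (a + (0 + (b + 0))) + 3)
                        ≡ (1 + 3 * c + 13 * a) + (1 + 3 * d + 13 * b) + 4
  regroup = solve-∀

output-as-sum : ∀ G → WellFormed G →
  3 * (#deg 4 (toUndirected G) + #deg 2 (toUndirected G)) + (10 * #deg 4 (toUndirected G) + length (UV (toUndirected G)))
    ≡ sumBy (λ v → vertexCost (indeg G v) (outdeg G v)) (V G)
output-as-sum G wf = begin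
  3 * (#deg 4 H₂ + #deg 2 H₂) + (10 * #deg 4 H₂ + length (UV H₂))
    ≡⟨ cong₂ (λ d₄ d₂ → 3 * (d₄ + d₂) + (10 * d₄ + length (UV H₂))) (census 4) (census 2) ⟩
  3 * (sumBy D₄ (V G) + sumBy D₂ (V G)) + (10 * sumBy D₄ (V G) + length (UV H₂))
    ≡⟨ cong₂ _+_ (cong (3 *_) (sym (sumBy-+ D₄ D₂ (V G)))) (cong₂ _+_ (sym (sumBy-* 10 D₄ (V G))) size) ⟩
  3 * sumBy (λ v → D₄ v + D₂ v) (V G) + (sumBy (λ v → 10 * D₄ v) (V G) + sumBy (λ _ → 3) (V G))
    ≡⟨ cong₂ _+_ (sym (sumBy-* 3 _ (V G))) (sym (sumBy-+ _ _ (V G))) ⟩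
  sumBy (λ v → 3 * (D₄ v + D₂ v)) (V G) + sumBy (λ v → 10 * D₄ v + 3) (V G)
    ≡⟨ sym (sumBy-+ _ _ (V G)) ⟩
  sumBy (λ v → vertexCost (indeg G v) (outdeg G v)) (V G) ∎
  where
  open ≡-Reasoning
  open Undirected G wf
  D₄ D₂ : ℕ → ℕ
  D₄ v = slotsOfDeg 4 (indeg G v) (outdeg G v)
  D₂ v = slotsOfDeg 2 (indeg G v) (outdeg G v)

hasDeg1-witness : ∀ H {z} → z ∈ UV H → udeg H z ≡ 1 → hasDeg1 H ≡ true
hasDeg1-witness H {z} z∈ deg≡1 = witness (UV H) z∈
  where
  witness : ∀ xs → z ∈ xs → any (λ x → udeg H x ≡ᵇ 1) xs ≡ true
  witness (x ∷ xs) (here refl) rewrite deg≡1 = refl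
  witness (x ∷ xs) (there z∈xs) rewrite witness xs z∈xs = ∨-zeroʳ _

-- so if step (4) does not output the Petersen graph, no vertex of the
-- digraph has in-degree 0: its a-vertex would still have degree 1
no-source : ∀ {G H₃ order} → WellFormed G → order ↭ verticesOfDeg 4 (toUndirected G) →
  GateBounds (toUndirected G) H₃ order → hasDeg1 H₃ ≡ false → ∀ v → v ∈ V G → 0 < indeg G v
no-source {G} {H₃} {order} wf order↭ gates no-deg1 v v∈ with indeg G v in indeg≡
... | suc _ = s≤s z≤n
... | zero = contradiction (trans (sym (hasDeg1-witness H₃ (proj₁ survives) (trans (proj₂ survives) degree-1))) no-deg1) (λ ())
  where
  open Undirected G wf
  a∈H₂ : aV v ∈ UV H₂
  a∈H₂ = ∈-concatMap⁺ (V G) v∈ (here refl)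
  degree-1 : udeg H₂ (aV v) ≡ 1
  degree-1 = trans (udeg-a v v∈) (cong suc indeg≡)
  not-gated : aV v ∉ order
  not-gated a∈order = subst T (cong (_≡ᵇ 4) degree-1)
    (proj₂ (∈-filterᵇ⁻ (λ x → udeg H₂ x ≡ᵇ 4) {xs = UV H₂} (∈-resp-↭ order↭ a∈order)))
  survives : aV v ∈ UV H₃ × udeg H₃ (aV v) ≡ udeg H₂ (aV v)
  survives = GateBounds.untouched gates (aV v) a∈H₂ not-gated

step3-simple : ∀ {G H₃} → WellFormed G → Step3 (toUndirected G) H₃ → Simple H₃
step3-simple {G} wf (_ , _ , gateAll) = GateBounds.simple-after (gateAll-bounds gateAll (Undirected.simple G wf))

step4-size : ∀ H₃ H → Simple H₃ → Step4 H₃ H →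
  H ≡ petersen ⊎ (hasDeg1 H₃ ≡ false × length (UV H) ≤ 3 * #deg 2 H₃ + length (UV H₃))
step4-size H₃ H simple step4 with hasDeg1 H₃
... | true = inj₁ step4
... | false with step4
...   | order , order↭ , diamonds = inj₂ (refl , subst (λ l → length (UV H) ≤ 3 * l + length (UV H₃))
          (↭-length order↭) (diamondAll-size diamonds unique members))
  where
  unique : Unique order
  unique = unique-↭ (↭-sym order↭) (Unique.filter⁺ _ (proj₁ simple))
  members : All (_∈ UV H₃) order
  members = tabulate (λ r∈ → proj₁ (∈-filterᵇ⁻ (λ x → udeg H₃ x ≡ᵇ 2) {xs = UV H₃} (∈-resp-↭ order↭ r∈)))

output≤Φ : ∀ {G H₃ H} → WellFormed G → Step3 (toUndirected G) H₃ → hasDeg1 H₃ ≡ false →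
  length (UV H) ≤ 3 * #deg 2 H₃ + length (UV H₃) → length (UV H) ≤ Φ G
output≤Φ {G} {H₃} {H} wf (order , order↭ , gateAll) no-deg1 diamonds = begin
  length (UV H)                                        ≤⟨ diamonds ⟩
  3 * #deg 2 H₃ + length (UV H₃)                       ≤⟨ +-mono-≤ (*-monoʳ-≤ 3 deg2-after) size-after ⟩
  3 * (length order + #deg 2 H₂) + (10 * length order + length (UV H₂))
                                                       ≡⟨ cong (λ l → 3 * (l + #deg 2 H₂) + (10 * l + length (UV H₂))) (↭-length order↭) ⟩
  3 * (#deg 4 H₂ + #deg 2 H₂) + (10 * #deg 4 H₂ + length (UV H₂)) ≡⟨ output-as-sum G wf ⟩
  sumBy (λ v → vertexCost (indeg G v) (outdeg G v)) (V G)
                      ≤⟨ sumBy-mono (V G) (λ v v∈ → vertexCost≤φ _ _ (no-source wf order↭ gates no-deg1 v v∈)) ⟩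
  Φ G                                                  ∎
  where
  open ≤-Reasoning
  open Undirected G wf using (H₂; simple)
  gates : GateBounds H₂ H₃ order
  gates = gateAll-bounds gateAll simple
  open GateBounds gates

degSum-positive : ∀ Γ → IsDigraph Γ → 0 < length (A Γ) → 1 ≤ degSum Γ
degSum-positive (digraph Vs (a ∷ as)) (_ , _ , (_ , tail∈Vs , _) ∷ _) _ = begin
  1                                     ≡⟨ cong 𝟙 (sym (≡ᵇ-refl (proj₁ a))) ⟩
  𝟙 (proj₁ a ≡ᵇ proj₁ a)                ≤⟨ m≤m+n _ _ ⟩
  sumBy (λ e → 𝟙 (proj₁ e ≡ᵇ proj₁ a)) (a ∷ as) ≡⟨ sym (outdeg-as-sum Γ (proj₁ a)) ⟩
  outdeg Γ (proj₁ a)                    ≤⟨ m≤n+m _ _ ⟩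
  indeg Γ (proj₁ a) + outdeg Γ (proj₁ a) ≤⟨ sumBy-member (λ v → indeg Γ v + outdeg Γ v) tail∈Vs ⟩
  degSum Γ                              ∎
  where
  open ≤-Reasoning
  Γ : Digraph
  Γ = digraph Vs (a ∷ as)

lemma5p4 : (Γ : Digraph) → IsDigraph Γ → 0 < length (A Γ) →
    (H : UGraph) → QuickConversion Γ H → length (UV H) ≤ 25 * degSum Γ
lemma5p4 Γ isDigraph hasArc H (G₁ , H₃ , step1 , step3 , step4)
  with step1-weight isDigraph step1
... | wf₁ , Φ₁≤ with step4-size H₃ H (step3-simple wf₁ step3) step4
...   | inj₁ refl = ≤-trans (by-evaluation {10} {25}) (*-monoʳ-≤ 25 (degSum-positive Γ isDigraph hasArc))
...   | inj₂ (no-deg1 , diamonds) = ≤-trans (output≤Φ {H = H} wf₁ step3 no-deg1 diamonds) Φ₁≤
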